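{- Let $G$ be a connected graph with $n\geq 2$ vertices and $m$ edges, and let $k\geq 0$ be an integer. Then $$R(S^k(G))=2^kR(G)+\frac{4^{k}-2^{k}}{2}R^+(G)+\frac{8^{k}-2\cdot 4^{k}+2^{k}}{4}R^*(G)+\frac{8^k-2^k}{12}\,m(2m-2n+1)-\frac{4^k-1}{6}(m-n)(m-n+1).$$
   Context: All graphs are finite, simple and connected. For a connected graph $H$, the resistance distance $\Omega_{ij}$ between vertices $i,j$ is the effective resistance between $i$ and $j$ in the electrical network obtained from $H$ by replacing each edge with a unit resistor. $d_i$ denotes the degree of vertex $i$ in $H$. The Kirchhoff index is $R(H)=\sum_{\{i,j\}\subseteq V(H)}\Omega_{ij}$, the multiplicative degree-Kirchhoff index is $R^*(H)=\sum_{\{i,j\}\subseteq V(H)} d_id_j\Omega_{ij}$ and the additive degree-Kirchhoff index is $R^+(H)=\sum_{\{i,j\}\subseteq V(H)}(d_i+d_j)\Omega_{ij}$, all over unordered pairs of distinct vertices. The subdivision $S(H)$ is obtained from $H$ by replacing every edge with a path of length two. The iterated subdivisions are $S^0(G)=G$ and $S^k(G)=S(S^{k-1}(G))$ for $k\geq 1$. -}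

module Defs where

open import Data.Nat using (ℕ; zero; suc; _^_; _<ᵇ_; _≤_)
open import Data.Fin using (Fin; toℕ; _↑ˡ_; _↑ʳ_; _≟_)
open import Data.Product using (Σ; _×_; _,_; proj₁; proj₂)
open import Data.Sum using (_⊎_)
open import Data.Bool using (Bool; true; false; if_then_else_)
open import Data.Integer using (+_)
open import Relation.Nullary using (¬_; does)
open import Relation.Binary.PropositionalEquality using (_≡_; _≢_)
open import Data.Rational using (ℚ; 0ℚ; 1ℚ; _+_; _-_; _*_; _/_)

-- A finite multigraph given by a vertex count, an edge count and an
-- enumeration of the edges as ordered pairs of endpoints (orientation
-- is irrelevant for everything below).
record Graph : Set where
  field
    n    : ℕ
    m    : ℕ
    edge : Fin m → Fin n × Fin n
open Graph public

SameEdge : {V : ℕ} → Fin V × Fin V → Fin V × Fin V → Set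
SameEdge (a , b) (c , d) = (a ≡ c × b ≡ d) ⊎ (a ≡ d × b ≡ c)

Simple : Graph → Set
Simple G = (∀ e → proj₁ (edge G e) ≢ proj₂ (edge G e))
         × (∀ e e′ → SameEdge (edge G e) (edge G e′) → e ≡ e′)

Adjacent : (G : Graph) → Fin (n G) → Fin (n G) → Set
Adjacent G u v = Σ (Fin (m G)) λ e → SameEdge (edge G e) (u , v)

data Reachable (G : Graph) : Fin (n G) → Fin (n G) → Set where
  here : ∀ {u} → Reachable G u u
  step : ∀ {u v w} → Adjacent G u v → Reachable G v w → Reachable G u w

Connected : Graph → Set
Connected G = ∀ u v → Reachable G u v

-- Subdivision: vertices Fin (n + m); old vertex u ↦ u ↑ˡ m,
-- the subdivision vertex of edge e ↦ n ↑ʳ e.  Edge e = (a , b)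
-- becomes the two edges (a , x_e) and (x_e , b).
S : Graph → Graph
S G = record
  { n = n G Data.Nat.+ m G
  ; m = m G Data.Nat.+ m G
  ; edge = λ i → sub (Data.Fin.splitAt (m G) i)
  }
  where
    sub : Fin (m G) ⊎ Fin (m G) → Fin (n G Data.Nat.+ m G) × Fin (n G Data.Nat.+ m G)
    sub (_⊎_.inj₁ e) = proj₁ (edge G e) ↑ˡ m G , n G ↑ʳ e
    sub (_⊎_.inj₂ e) = n G ↑ʳ e , proj₂ (edge G e) ↑ˡ m G

Sᵏ : ℕ → Graph → Graph
Sᵏ zero    G = G
Sᵏ (suc k) G = S (Sᵏ k G)

sumFin : (N : ℕ) → (Fin N → ℚ) → ℚ
sumFin zero    f = 0ℚ
sumFin (suc N) f = f Data.Fin.zero + sumFin N (λ i → f (Data.Fin.suc i))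

pairSum : (N : ℕ) → (Fin N → Fin N → ℚ) → ℚ
pairSum N f = sumFin N λ i → sumFin N λ j →
  if toℕ i <ᵇ toℕ j then f i j else 0ℚ

ℕ→ℚ : ℕ → ℚ
ℕ→ℚ k = (+ k) / 1

δ : {N : ℕ} → Fin N → Fin N → ℚ
δ u v = if does (u ≟ v) then 1ℚ else 0ℚ

deg : (G : Graph) → Fin (n G) → ℚ
deg G v = sumFin (m G) λ e → δ (proj₁ (edge G e)) v + δ (proj₂ (edge G e)) v

laplacian : (G : Graph) → (Fin (n G) → ℚ) → Fin (n G) → ℚ
laplacian G x v = sumFin (m G) λ e →
  let a = proj₁ (edge G e) ; b = proj₂ (edge G e) in
  (δ a v - δ b v) * (x a - x b)

-- Effective resistance with unit resistors: r is the resistance between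
-- i and j iff there is a potential x with L x = e_i − e_j (unit current
-- injected at i, extracted at j, Kirchhoff's and Ohm's laws) and
-- r = x_i − x_j.
IsResistance : (G : Graph) → Fin (n G) → Fin (n G) → ℚ → Set
IsResistance G i j r =
  Σ (Fin (n G) → ℚ) λ x →
    (∀ v → laplacian G x v ≡ δ i v - δ j v) × (r ≡ x i - x j)

IsResistanceDistance : (G : Graph) → (Fin (n G) → Fin (n G) → ℚ) → Set
IsResistanceDistance G Ω = ∀ i j → IsResistance G i j (Ω i j)

Kf : (G : Graph) → (Fin (n G) → Fin (n G) → ℚ) → ℚ
Kf G Ω = pairSum (n G) Ω

KfMul : (G : Graph) → (Fin (n G) → Fin (n G) → ℚ) → ℚ
KfMul G Ω = pairSum (n G) λ i j → deg G i * deg G j * Ω i j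

KfAdd : (G : Graph) → (Fin (n G) → Fin (n G) → ℚ) → ℚ
KfAdd G Ω = pairSum (n G) λ i j → (deg G i + deg G j) * Ω i j

PairFn : Graph → Set
PairFn G = Fin (n G) → Fin (n G) → ℚ

-- Effective resistances are read off potentials: Ω i j = x i − x j for any x with L x = eᵢ − eⱼ,
-- and by the symmetry of L all such differences agree.  In S H each edge becomes two unit
-- resistors in series; interpolating a potential of H linearly at the new midpoints and adding a
-- correction supported on the midpoints gives potentials of S H, hence closed formulas for all
-- resistances of S H in terms of those of H.  Summing these, with Foster's theorem
-- Σₑ Ω (a e) (b e) = n − 1, expresses Kf, KfAdd and KfMul of S H linearly in those of H, plus
-- polynomials in n and m.  As n (S H) = n + m and m (S H) = 2 m, the difference m − n is
-- invariant, and the resulting linear recurrence is solved in closed form in 2ᵏ.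
module Submission where

open import Defs
open import Data.Bool using (true; false; if_then_else_)
open import Data.Empty using (⊥-elim)
open import Data.Fin using (Fin; toℕ; _↑ˡ_; _↑ʳ_; _≟_; splitAt)
import Data.Fin as Fin
import Data.Fin.Properties as Fin
open import Data.Integer using (+_)
open import Data.Nat using (ℕ; zero; suc; _≤_; _^_; _<ᵇ_)
import Data.Nat as ℕ
import Data.Nat.Properties as ℕ
open import Data.Nat.Coprimality using (1-coprimeTo)
import Data.Nat.Coprimality as Coprime
open import Data.Product using (Σ; _,_; proj₁; proj₂)
open import Data.Rational using (ℚ; 0ℚ; 1ℚ; ½; _+_; _-_; _*_; _/_; -_; mkℚ)
open import Data.Rational.Properties
  using (+-identityˡ; +-identityʳ; +-assoc; +-comm; *-assoc; *-distribʳ-+; *-zeroˡ; *-zeroʳ;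
         *-identityˡ; *-identityʳ; *-comm; normalize-coprime)
open import Data.Rational.Solver using (module +-*-Solver)
open import Data.Sum using (inj₁; inj₂; [_,_]′)
open import Function using (_∘_)
open import Function.Definitions using (Injective)
open import Relation.Nullary using (yes; no; ofʸ; ofⁿ)
open import Relation.Binary.PropositionalEquality
open +-*-Solver

^-distribʳ-* : ∀ x y k → (x ℕ.* y) ^ k ≡ x ^ k ℕ.* y ^ k
^-distribʳ-* x y zero    = refl
^-distribʳ-* x y (suc k) = trans (cong (x ℕ.* y ℕ.*_) (^-distribʳ-* x y k)) (ℕ.[m*n]*[o*p]≡[m*o]*[n*p] x y (x ^ k) (y ^ k))

cong₃ : ∀ {A B C D : Set} (f : A → B → C → D) {x x′ y y′ z z′} →
        x ≡ x′ → y ≡ y′ → z ≡ z′ → f x y z ≡ f x′ y′ z′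
cong₃ f refl refl refl = refl

sumFin-cong : ∀ N {f g : Fin N → ℚ} → (∀ i → f i ≡ g i) → sumFin N f ≡ sumFin N g
sumFin-cong zero    f≗g = refl
sumFin-cong (suc N) f≗g = cong₂ _+_ (f≗g Fin.zero) (sumFin-cong N (f≗g ∘ Fin.suc))

sumFin-+ : ∀ N (f g : Fin N → ℚ) → sumFin N (λ i → f i + g i) ≡ sumFin N f + sumFin N g
sumFin-+ zero    f g = refl
sumFin-+ (suc N) f g = trans (cong (_+_ (f Fin.zero + g Fin.zero)) (sumFin-+ N (f ∘ Fin.suc) (g ∘ Fin.suc)))
  (solve 4 (λ a b c d → (a :+ b) :+ (c :+ d) := (a :+ c) :+ (b :+ d)) refl
     (f Fin.zero) (g Fin.zero) (sumFin N (f ∘ Fin.suc)) (sumFin N (g ∘ Fin.suc)))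

sumFin-*ˡ : ∀ N c (f : Fin N → ℚ) → sumFin N (λ i → c * f i) ≡ c * sumFin N f
sumFin-*ˡ zero    c f = sym (*-zeroʳ c)
sumFin-*ˡ (suc N) c f = trans (cong (_+_ (c * f Fin.zero)) (sumFin-*ˡ N c (f ∘ Fin.suc)))
  (solve 3 (λ c a b → c :* a :+ c :* b := c :* (a :+ b)) refl c (f Fin.zero) (sumFin N (f ∘ Fin.suc)))

sumFin-*ʳ : ∀ N c (f : Fin N → ℚ) → sumFin N (λ i → f i * c) ≡ sumFin N f * c
sumFin-*ʳ N c f = trans (sumFin-cong N (λ i → *-comm (f i) c))
  (trans (sumFin-*ˡ N c f) (*-comm c (sumFin N f)))

sumFin-neg : ∀ N (f : Fin N → ℚ) → sumFin N (λ i → - f i) ≡ - sumFin N f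
sumFin-neg zero    f = refl
sumFin-neg (suc N) f = trans (cong (_+_ (- f Fin.zero)) (sumFin-neg N (f ∘ Fin.suc)))
  (solve 2 (λ a b → :- a :+ :- b := :- (a :+ b)) refl (f Fin.zero) (sumFin N (f ∘ Fin.suc)))

sumFin-- : ∀ N (f g : Fin N → ℚ) → sumFin N (λ i → f i - g i) ≡ sumFin N f - sumFin N g
sumFin-- N f g = trans (sumFin-+ N f (λ i → - g i)) (cong (_+_ (sumFin N f)) (sumFin-neg N g))

sumFin-zero : ∀ N → sumFin N (λ _ → 0ℚ) ≡ 0ℚ
sumFin-zero zero    = refl
sumFin-zero (suc N) = cong (_+_ 0ℚ) (sumFin-zero N)

sumFin-comm : ∀ N M (f : Fin N → Fin M → ℚ) →
  sumFin N (λ i → sumFin M (f i)) ≡ sumFin M (λ j → sumFin N (λ i → f i j))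
sumFin-comm zero    M f = sym (sumFin-zero M)
sumFin-comm (suc N) M f = trans (cong (_+_ (sumFin M (f Fin.zero))) (sumFin-comm N M (f ∘ Fin.suc)))
  (sym (sumFin-+ M (f Fin.zero) (λ j → sumFin N (λ i → f (Fin.suc i) j))))

sumFin-↑ : ∀ N M (f : Fin (N ℕ.+ M) → ℚ) →
  sumFin (N ℕ.+ M) f ≡ sumFin N (λ i → f (i ↑ˡ M)) + sumFin M (λ j → f (N ↑ʳ j))
sumFin-↑ zero    M f = sym (+-identityˡ _)
sumFin-↑ (suc N) M f = trans (cong (_+_ (f Fin.zero)) (sumFin-↑ N M (f ∘ Fin.suc)))
  (sym (+-assoc (f Fin.zero) _ _))

private
  mkℕℚ : ℕ → ℚ
  mkℕℚ k = mkℚ (+ k) 0 (Coprime.sym (1-coprimeTo k))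

  ℕ→ℚ≡mkℕℚ : ∀ k → ℕ→ℚ k ≡ mkℕℚ k
  ℕ→ℚ≡mkℕℚ k = normalize-coprime (Coprime.sym (1-coprimeTo k))

ℕ→ℚ-suc : ∀ k → ℕ→ℚ (suc k) ≡ 1ℚ + ℕ→ℚ k
ℕ→ℚ-suc zero    = refl
ℕ→ℚ-suc (suc k) = begin
  ℕ→ℚ (suc (suc k))             ≡⟨ ℕ→ℚ≡mkℕℚ (suc (suc k)) ⟩
  mkℕℚ (suc (suc k))            ≡⟨ cong (mkℕℚ ∘ suc) (sym (ℕ.*-identityʳ (suc k))) ⟩
  mkℕℚ (suc (suc k ℕ.* 1))      ≡⟨ ℕ→ℚ≡mkℕℚ (suc (suc k ℕ.* 1)) ⟨  -- 1ℚ + mkℕℚ j reduces to ℕ→ℚ (1 + j * 1)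
  1ℚ + mkℕℚ (suc k)             ≡⟨ cong (_+_ 1ℚ) (ℕ→ℚ≡mkℕℚ (suc k)) ⟨
  1ℚ + ℕ→ℚ (suc k)              ∎
  where open ≡-Reasoning

sumFin-const : ∀ N c → sumFin N (λ _ → c) ≡ ℕ→ℚ N * c
sumFin-const zero    c = sym (*-zeroˡ c)
sumFin-const (suc N) c = trans (cong (_+_ c) (sumFin-const N c))
  (trans (solve 2 (λ c n → c :+ n :* c := (con 1ℚ :+ n) :* c) refl c (ℕ→ℚ N))
         (cong (_* c) (sym (ℕ→ℚ-suc N))))

ℕ→ℚ-+ : ∀ x y → ℕ→ℚ (x ℕ.+ y) ≡ ℕ→ℚ x + ℕ→ℚ y
ℕ→ℚ-+ zero    y = sym (+-identityˡ (ℕ→ℚ y))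
ℕ→ℚ-+ (suc x) y = begin
  ℕ→ℚ (suc (x ℕ.+ y))        ≡⟨ ℕ→ℚ-suc (x ℕ.+ y) ⟩
  1ℚ + ℕ→ℚ (x ℕ.+ y)         ≡⟨ cong (_+_ 1ℚ) (ℕ→ℚ-+ x y) ⟩
  1ℚ + (ℕ→ℚ x + ℕ→ℚ y)       ≡⟨ +-assoc 1ℚ (ℕ→ℚ x) (ℕ→ℚ y) ⟨
  (1ℚ + ℕ→ℚ x) + ℕ→ℚ y       ≡⟨ cong (_+ ℕ→ℚ y) (ℕ→ℚ-suc x) ⟨
  ℕ→ℚ (suc x) + ℕ→ℚ y        ∎
  where open ≡-Reasoning

ℕ→ℚ-* : ∀ x y → ℕ→ℚ (x ℕ.* y) ≡ ℕ→ℚ x * ℕ→ℚ y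
ℕ→ℚ-* zero    y = sym (*-zeroˡ (ℕ→ℚ y))
ℕ→ℚ-* (suc x) y = begin
  ℕ→ℚ (y ℕ.+ x ℕ.* y)          ≡⟨ ℕ→ℚ-+ y (x ℕ.* y) ⟩
  ℕ→ℚ y + ℕ→ℚ (x ℕ.* y)        ≡⟨ cong (_+_ (ℕ→ℚ y)) (ℕ→ℚ-* x y) ⟩
  ℕ→ℚ y + ℕ→ℚ x * ℕ→ℚ y        ≡⟨ solve 2 (λ x y → y :+ x :* y := (con 1ℚ :+ x) :* y) refl (ℕ→ℚ x) (ℕ→ℚ y) ⟩
  (1ℚ + ℕ→ℚ x) * ℕ→ℚ y         ≡⟨ cong (_* ℕ→ℚ y) (ℕ→ℚ-suc x) ⟨
  ℕ→ℚ (suc x) * ℕ→ℚ y          ∎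
  where open ≡-Reasoning

δ-refl : ∀ {N} (u : Fin N) → δ u u ≡ 1ℚ
δ-refl u with u ≟ u
... | yes _  = refl
... | no u≢u = ⊥-elim (u≢u refl)

δ-≢ : ∀ {N} {u v : Fin N} → u ≢ v → δ u v ≡ 0ℚ
δ-≢ {u = u} {v} u≢v with u ≟ v
... | yes u≡v = ⊥-elim (u≢v u≡v)
... | no _    = refl

δ-sym : ∀ {N} (u v : Fin N) → δ u v ≡ δ v u
δ-sym u v with u ≟ v
... | yes refl = sym (δ-refl u)
... | no u≢v   = sym (δ-≢ (u≢v ∘ sym))

δ-injective : ∀ {N M} {f : Fin N → Fin M} → Injective _≡_ _≡_ f → ∀ u v → δ (f u) (f v) ≡ δ u v
δ-injective {f = f} f-inj u v with f u ≟ f v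
... | yes fu≡fv = sym (trans (cong (δ u) (sym (f-inj fu≡fv))) (δ-refl u))
... | no fu≢fv  = sym (δ-≢ (fu≢fv ∘ cong f))

sumFin-δ : ∀ N (u : Fin N) (f : Fin N → ℚ) → sumFin N (λ v → δ u v * f v) ≡ f u
sumFin-δ (suc N) Fin.zero f = trans
  (cong₂ _+_ (*-identityˡ (f Fin.zero)) (trans (sumFin-cong N (λ i → *-zeroˡ (f (Fin.suc i)))) (sumFin-zero N)))
  (+-identityʳ (f Fin.zero))
sumFin-δ (suc N) (Fin.suc u) f = trans
  (cong₂ _+_ (*-zeroˡ (f Fin.zero)) (sumFin-δ N u (f ∘ Fin.suc)))
  (+-identityˡ (f (Fin.suc u)))

sumFin-δʳ : ∀ N (u : Fin N) (f : Fin N → ℚ) → sumFin N (λ v → f v * δ v u) ≡ f u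
sumFin-δʳ N u f = trans (sumFin-cong N (λ v → trans (*-comm (f v) (δ v u)) (cong (_* f v) (δ-sym v u))))
  (sumFin-δ N u f)

sumFin-δ-one : ∀ N (u : Fin N) → sumFin N (δ u) ≡ 1ℚ
sumFin-δ-one N u = trans (sumFin-cong N (λ v → sym (*-identityʳ (δ u v)))) (sumFin-δ N u (λ _ → 1ℚ))

sumFin-dipole : ∀ N (i j : Fin N) (y : Fin N → ℚ) → sumFin N (λ v → (δ i v - δ j v) * y v) ≡ y i - y j
sumFin-dipole N i j y = begin
  sumFin N (λ v → (δ i v - δ j v) * y v)                  ≡⟨ sumFin-cong N (λ v →
     solve 3 (λ p q a → (p :- q) :* a := p :* a :- q :* a) refl (δ i v) (δ j v) (y v)) ⟩
  sumFin N (λ v → δ i v * y v - δ j v * y v)              ≡⟨ sumFin-- N _ _ ⟩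
  sumFin N (λ v → δ i v * y v) - sumFin N (λ v → δ j v * y v)  ≡⟨ cong₂ _-_ (sumFin-δ N i y) (sumFin-δ N j y) ⟩
  y i - y j                                               ∎
  where open ≡-Reasoning

split-by-order : ∀ {N} (i j : Fin N) (x : ℚ) →
  x ≡ (if toℕ i <ᵇ toℕ j then x else 0ℚ) + (if toℕ j <ᵇ toℕ i then x else 0ℚ) + δ i j * x
split-by-order i j x with toℕ i <ᵇ toℕ j | ℕ.<ᵇ-reflects-< (toℕ i) (toℕ j)
                        | toℕ j <ᵇ toℕ i | ℕ.<ᵇ-reflects-< (toℕ j) (toℕ i)
... | true  | ofʸ i<j | true  | ofʸ j<i = ⊥-elim (ℕ.<-asym i<j j<i)
... | true  | ofʸ i<j | false | _       rewrite δ-≢ (ℕ.<⇒≢ i<j ∘ cong toℕ) =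
  solve 1 (λ x → x := x :+ con 0ℚ :+ con 0ℚ :* x) refl x
... | false | _       | true  | ofʸ j<i rewrite δ-≢ (ℕ.<⇒≢ j<i ∘ cong toℕ ∘ sym) =
  solve 1 (λ x → x := con 0ℚ :+ x :+ con 0ℚ :* x) refl x
... | false | ofⁿ i≮j | false | ofⁿ j≮i
  rewrite Fin.toℕ-injective (ℕ.≤-antisym (ℕ.≮⇒≥ j≮i) (ℕ.≮⇒≥ i≮j)) | δ-refl j =
  solve 1 (λ x → x := con 0ℚ :+ con 0ℚ :+ con 1ℚ :* x) refl x

pairSum-cong : ∀ N {f g : Fin N → Fin N → ℚ} → (∀ i j → f i j ≡ g i j) → pairSum N f ≡ pairSum N g
pairSum-cong N f≗g = sumFin-cong N (λ i → sumFin-cong N (λ j →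
  cong (λ x → if toℕ i <ᵇ toℕ j then x else 0ℚ) (f≗g i j)))

sumFin²-by-order : ∀ N (f : Fin N → Fin N → ℚ) →
  sumFin N (λ i → sumFin N (f i)) ≡ pairSum N f + pairSum N (λ i j → f j i) + sumFin N (λ i → f i i)
sumFin²-by-order N f = begin
  sumFin N (λ i → sumFin N (f i))
    ≡⟨ sumFin-cong N (λ i → trans (sumFin-cong N (λ j → split-by-order i j (f i j)))
                                  (trans (sumFin-+ N _ _) (cong₂ _+_ (sumFin-+ N _ _) (sumFin-δ N i (f i))))) ⟩
  sumFin N (λ i → sumFin N (λ j → if toℕ i <ᵇ toℕ j then f i j else 0ℚ)
                + sumFin N (λ j → if toℕ j <ᵇ toℕ i then f i j else 0ℚ) + f i i)
    ≡⟨ trans (sumFin-+ N _ _) (cong (_+ sumFin N (λ i → f i i)) (sumFin-+ N _ _)) ⟩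
  pairSum N f + sumFin N (λ i → sumFin N (λ j → if toℕ j <ᵇ toℕ i then f i j else 0ℚ))
              + sumFin N (λ i → f i i)
    ≡⟨ cong (λ s → pairSum N f + s + sumFin N (λ i → f i i)) (sumFin-comm N N _) ⟩
  pairSum N f + pairSum N (λ i j → f j i) + sumFin N (λ i → f i i)  ∎
  where open ≡-Reasoning

pairSum-half : ∀ N (f : Fin N → Fin N → ℚ) → (∀ i j → f j i ≡ f i j) → (∀ i → f i i ≡ 0ℚ) →
  pairSum N f ≡ sumFin N (λ i → sumFin N (f i)) * ½
pairSum-half N f f-sym f-diag = sym (begin
  sumFin N (λ i → sumFin N (f i)) * ½
    ≡⟨ cong (_* ½) (sumFin²-by-order N f) ⟩
  (pairSum N f + pairSum N (λ i j → f j i) + sumFin N (λ i → f i i)) * ½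
    ≡⟨ cong₂ (λ p d → (pairSum N f + p + d) * ½) (pairSum-cong N f-sym) (trans (sumFin-cong N f-diag) (sumFin-zero N)) ⟩
  (pairSum N f + pairSum N f + 0ℚ) * ½
    ≡⟨ solve 1 (λ p → (p :+ p :+ con 0ℚ) :* con ½ := p) refl (pairSum N f) ⟩
  pairSum N f  ∎)
  where open ≡-Reasoning

-- Laplacian, potentials and effective resistance

end₁ end₂ : (H : Graph) → Fin (m H) → Fin (n H)
end₁ H e = proj₁ (edge H e)
end₂ H e = proj₂ (edge H e)

module _ (H : Graph) where

  private
    V = n H
    E = m H
    a = end₁ H
    b = end₂ H
    L = laplacian H

  laplacian-energy : ∀ (x y : Fin V → ℚ) →
    sumFin V (λ v → L x v * y v) ≡ sumFin E (λ e → (x (a e) - x (b e)) * (y (a e) - y (b e)))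
  laplacian-energy x y = begin
    sumFin V (λ v → L x v * y v)
      ≡⟨ sumFin-cong V (λ v → sym (sumFin-*ʳ E (y v) _)) ⟩
    sumFin V (λ v → sumFin E (λ e → (δ (a e) v - δ (b e) v) * Δx e * y v))
      ≡⟨ sumFin-comm V E _ ⟩
    sumFin E (λ e → sumFin V (λ v → (δ (a e) v - δ (b e) v) * Δx e * y v))
      ≡⟨ sumFin-cong E (λ e → trans (sumFin-cong V (λ v →
           solve 3 (λ d D y → d :* D :* y := D :* (d :* y)) refl (δ (a e) v - δ (b e) v) (Δx e) (y v)))
           (sumFin-*ˡ V (Δx e) _)) ⟩
    sumFin E (λ e → Δx e * sumFin V (λ v → (δ (a e) v - δ (b e) v) * y v))
      ≡⟨ sumFin-cong E (λ e → cong (Δx e *_) (sumFin-dipole V (a e) (b e) y)) ⟩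
    sumFin E (λ e → Δx e * (y (a e) - y (b e)))  ∎
    where
    open ≡-Reasoning
    Δx : Fin E → ℚ
    Δx e = x (a e) - x (b e)

  laplacian-symmetric : ∀ (x y : Fin V → ℚ) → sumFin V (λ v → L x v * y v) ≡ sumFin V (λ v → L y v * x v)
  laplacian-symmetric x y = trans (laplacian-energy x y)
    (trans (sumFin-cong E (λ e → *-comm (x (a e) - x (b e)) (y (a e) - y (b e)))) (sym (laplacian-energy y x)))

  laplacian-+ : ∀ (x y : Fin V → ℚ) w → L (λ v → x v + y v) w ≡ L x w + L y w
  laplacian-+ x y w = trans (sumFin-cong E (λ e →
    solve 6 (λ p q xa xb ya yb → (p :- q) :* ((xa :+ ya) :- (xb :+ yb)) := (p :- q) :* (xa :- xb) :+ (p :- q) :* (ya :- yb))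
      refl (δ (a e) w) (δ (b e) w) (x (a e)) (x (b e)) (y (a e)) (y (b e))))
    (sumFin-+ E _ _)

  laplacian-neg : ∀ (x : Fin V → ℚ) w → L (λ v → - x v) w ≡ - L x w
  laplacian-neg x w = trans (sumFin-cong E (λ e →
    solve 4 (λ p q xa xb → (p :- q) :* (:- xa :- :- xb) := :- ((p :- q) :* (xa :- xb)))
      refl (δ (a e) w) (δ (b e) w) (x (a e)) (x (b e))))
    (sumFin-neg E _)

  laplacian-- : ∀ (x y : Fin V → ℚ) w → L (λ v → x v - y v) w ≡ L x w - L y w
  laplacian-- x y w = trans (laplacian-+ x (λ v → - y v) w) (cong (_+_ (L x w)) (laplacian-neg y w))

  potential-reciprocity : ∀ (x y : Fin V → ℚ) {i j k l} →
    (∀ v → L x v ≡ δ i v - δ j v) → (∀ v → L y v ≡ δ k v - δ l v) → y i - y j ≡ x k - x l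
  potential-reciprocity x y {i} {j} {k} {l} Lx Ly = begin
    y i - y j                                  ≡⟨ sumFin-dipole V i j y ⟨
    sumFin V (λ v → (δ i v - δ j v) * y v)     ≡⟨ sumFin-cong V (λ v → cong (_* y v) (Lx v)) ⟨
    sumFin V (λ v → L x v * y v)               ≡⟨ laplacian-symmetric x y ⟩
    sumFin V (λ v → L y v * x v)               ≡⟨ sumFin-cong V (λ v → cong (_* x v) (Ly v)) ⟩
    sumFin V (λ v → (δ k v - δ l v) * x v)     ≡⟨ sumFin-dipole V k l x ⟩
    x k - x l                                  ∎
    where open ≡-Reasoning

  IsResistance-flip : ∀ {i j r} → IsResistance H j i r → IsResistance H i j r
  IsResistance-flip {i} {j} (x , Lx , r≡) = (λ v → - x v)
    , (λ v → trans (laplacian-neg x v) (trans (cong -_ (Lx v))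
               (solve 2 (λ p q → :- (p :- q) := q :- p) refl (δ j v) (δ i v))))
    , trans r≡ (solve 2 (λ p q → q :- p := :- p :- :- q) refl (x i) (x j))

  IsResistance-unique : ∀ {i j r r′} → IsResistance H i j r → IsResistance H i j r′ → r ≡ r′
  IsResistance-unique (x , Lx , r≡) (y , Ly , r′≡) = trans r≡ (trans (potential-reciprocity y x Ly Lx) (sym r′≡))

  sumFin-deg : ∀ (F : Fin V → ℚ) → sumFin V (λ i → deg H i * F i) ≡ sumFin E (λ e → F (a e) + F (b e))
  sumFin-deg F = begin
    sumFin V (λ i → deg H i * F i)
      ≡⟨ sumFin-cong V (λ i → sym (sumFin-*ʳ E (F i) _)) ⟩
    sumFin V (λ i → sumFin E (λ e → (δ (a e) i + δ (b e) i) * F i))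
      ≡⟨ sumFin-comm V E _ ⟩
    sumFin E (λ e → sumFin V (λ i → (δ (a e) i + δ (b e) i) * F i))
      ≡⟨ sumFin-cong E (λ e → trans (sumFin-cong V (λ i →
           solve 3 (λ p q f → (p :+ q) :* f := p :* f :+ q :* f) refl (δ (a e) i) (δ (b e) i) (F i)))
           (trans (sumFin-+ V _ _) (cong₂ _+_ (sumFin-δ V (a e) F) (sumFin-δ V (b e) F)))) ⟩
    sumFin E (λ e → F (a e) + F (b e))  ∎
    where open ≡-Reasoning

  totalResistance : PairFn H → ℚ
  totalResistance Ω = sumFin V (λ u → sumFin V (Ω u))

  endpointResistance : PairFn H → ℚ
  endpointResistance Ω = sumFin E (λ e → sumFin V (λ v → Ω (a e) v + Ω (b e) v))

  edgeResistance : PairFn H → Fin E → Fin E → ℚ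
  edgeResistance Ω e f = Ω (a e) (a f) + Ω (a e) (b f) + Ω (b e) (a f) + Ω (b e) (b f)

  totalEdgeResistance : PairFn H → ℚ
  totalEdgeResistance Ω = sumFin E (λ e → sumFin E (edgeResistance Ω e))

  module _ {Ω : PairFn H} (isRD : IsResistanceDistance H Ω) where

    potential : Fin V → Fin V → Fin V → ℚ
    potential i j = proj₁ (isRD i j)

    laplacian-potential : ∀ i j v → L (potential i j) v ≡ δ i v - δ j v
    laplacian-potential i j = proj₁ (proj₂ (isRD i j))

    resistance≡potential : ∀ i j → Ω i j ≡ potential i j i - potential i j j
    resistance≡potential i j = proj₂ (proj₂ (isRD i j))

    resistance-diag : ∀ i → Ω i i ≡ 0ℚ
    resistance-diag i = trans (resistance≡potential i i)
      (solve 1 (λ p → p :- p := con 0ℚ) refl (potential i i i))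

    resistance-sym : ∀ i j → Ω j i ≡ Ω i j
    resistance-sym i j = IsResistance-unique (isRD j i) (IsResistance-flip (isRD i j))

    potential-from-resistances : ∀ i j k → potential i j k - potential i j j ≡ (Ω i j + Ω k j - Ω i k) * ½
    potential-from-resistances i j k = sym (begin
      (Ω i j + Ω k j - Ω i k) * ½
        ≡⟨ cong₂ (λ r s → (r + s - Ω i k) * ½) (resistance≡potential i j) (resistance≡potential k j) ⟩
      (P i - P j + (Q k - Q j) - Ω i k) * ½
        ≡⟨ cong (λ r → (P i - P j + (Q k - Q j) - r) * ½) Ωik ⟩
      (P i - P j + (Q k - Q j) - (P i - Q i - (P k - Q k))) * ½
        ≡⟨ cong (λ q → (P i - P j + (Q k - Q j) - (P i - q - (P k - Q k))) * ½) Qi ⟩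
      (P i - P j + (Q k - Q j) - (P i - (P k - P j + Q j) - (P k - Q k))) * ½
        ≡⟨ solve 5 (λ Pi Pj Pk Qj Qk → (Pi :- Pj :+ (Qk :- Qj) :- (Pi :- (Pk :- Pj :+ Qj) :- (Pk :- Qk))) :* con ½
                                       := Pk :- Pj) refl (P i) (P j) (P k) (Q j) (Q k) ⟩
      P k - P j  ∎)
      where
      open ≡-Reasoning
      P Q : Fin V → ℚ
      P = potential i j
      Q = potential k j
      LP-Q : ∀ v → L (λ w → P w - Q w) v ≡ δ i v - δ k v
      LP-Q v = trans (laplacian-- P Q v) (trans (cong₂ _-_ (laplacian-potential i j v) (laplacian-potential k j v))
        (solve 3 (λ p q r → p :- q :- (r :- q) := p :- r) refl (δ i v) (δ j v) (δ k v)))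
      Ωik : Ω i k ≡ P i - Q i - (P k - Q k)
      Ωik = trans (resistance≡potential i k)
        (potential-reciprocity (λ w → P w - Q w) (potential i k) LP-Q (laplacian-potential i k))
      Qi : Q i ≡ P k - P j + Q j
      Qi = trans (solve 2 (λ q q′ → q := q :- q′ :+ q′) refl (Q i) (Q j))
        (cong (_+ Q j) (potential-reciprocity P Q (laplacian-potential i j) (laplacian-potential k j)))

    resistance-via-common-sink : ∀ i j r →
      (potential i r i - potential i r j) - (potential j r i - potential j r j) ≡ Ω i j
    resistance-via-common-sink i j r = begin
      (P i - P j) - (Q i - Q j)
        ≡⟨ solve 6 (λ Pi Pj Pr Qi Qj Qr → (Pi :- Pj) :- (Qi :- Qj) := ((Pi :- Pr) :- (Pj :- Pr)) :- ((Qi :- Qr) :- (Qj :- Qr)))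
             refl (P i) (P j) (P r) (Q i) (Q j) (Q r) ⟩
      ((P i - P r) - (P j - P r)) - ((Q i - Q r) - (Q j - Q r))
        ≡⟨ cong₂ _-_ (cong₂ _-_ (potential-from-resistances i r i) (potential-from-resistances i r j))
                     (cong₂ _-_ (potential-from-resistances j r i) (potential-from-resistances j r j)) ⟩
      ((Ω i r + Ω i r - Ω i i) * ½ - (Ω i r + Ω j r - Ω i j) * ½)
        - ((Ω j r + Ω i r - Ω j i) * ½ - (Ω j r + Ω j r - Ω j j) * ½)
        ≡⟨ cong₃ (λ x y z → ((Ω i r + Ω i r - x) * ½ - (Ω i r + Ω j r - Ω i j) * ½)
                              - ((Ω j r + Ω i r - y) * ½ - (Ω j r + Ω j r - z) * ½))
             (resistance-diag i) (resistance-sym i j) (resistance-diag j) ⟩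
      ((Ω i r + Ω i r - 0ℚ) * ½ - (Ω i r + Ω j r - Ω i j) * ½)
        - ((Ω j r + Ω i r - Ω i j) * ½ - (Ω j r + Ω j r - 0ℚ) * ½)
        ≡⟨ solve 3 (λ x y z → ((x :+ x :- con 0ℚ) :* con ½ :- (x :+ y :- z) :* con ½)
                               :- ((y :+ x :- z) :* con ½ :- (y :+ y :- con 0ℚ) :* con ½) := z)
             refl (Ω i r) (Ω j r) (Ω i j) ⟩
      Ω i j  ∎
      where
      open ≡-Reasoning
      P Q : Fin V → ℚ
      P = potential i r
      Q = potential j r

    -- Foster's theorem: Σᵢ (L (potential i r)) i = n − 1, and swapping the two sums turns the
    -- left-hand side into Σₑ Ω (a e) (b e).
    foster : Fin V → sumFin E (λ e → Ω (a e) (b e)) ≡ ℕ→ℚ V - 1ℚ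
    foster r = sym (begin
      ℕ→ℚ V - 1ℚ
        ≡⟨ cong₂ _-_ (trans (sym (*-identityʳ (ℕ→ℚ V))) (sym (sumFin-const V 1ℚ))) (sym (sumFin-δ-one V r)) ⟩
      sumFin V (λ _ → 1ℚ) - sumFin V (δ r)
        ≡⟨ sumFin-- V _ _ ⟨
      sumFin V (λ i → 1ℚ - δ r i)
        ≡⟨ sumFin-cong V (λ i → trans (cong (_- δ r i) (sym (δ-refl i))) (sym (laplacian-potential i r i))) ⟩
      sumFin V (λ i → L (potential i r) i)
        ≡⟨ sumFin-comm V E _ ⟩
      sumFin E (λ e → sumFin V (λ i → (δ (a e) i - δ (b e) i) * (potential i r (a e) - potential i r (b e))))
        ≡⟨ sumFin-cong E (λ e → trans (sumFin-dipole V (a e) (b e) _) (resistance-via-common-sink (a e) (b e) r)) ⟩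
      sumFin E (λ e → Ω (a e) (b e))  ∎)
      where open ≡-Reasoning

    Kf≡½totalResistance : Kf H Ω ≡ totalResistance Ω * ½
    Kf≡½totalResistance = pairSum-half V Ω resistance-sym resistance-diag

    KfAdd≡endpointResistance : KfAdd H Ω ≡ endpointResistance Ω
    KfAdd≡endpointResistance = begin
      KfAdd H Ω
        ≡⟨ pairSum-half V (λ i j → (deg H i + deg H j) * Ω i j)
             (λ i j → cong₂ _*_ (+-comm (deg H j) (deg H i)) (resistance-sym i j))
             (λ i → trans (cong ((deg H i + deg H i) *_) (resistance-diag i)) (*-zeroʳ (deg H i + deg H i))) ⟩
      sumFin V (λ i → sumFin V (λ j → (deg H i + deg H j) * Ω i j)) * ½
        ≡⟨ cong (_* ½) (trans (sumFin-cong V (λ i → trans (sumFin-cong V (λ j → *-distribʳ-+ (Ω i j) (deg H i) (deg H j)))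
                                                          (sumFin-+ V _ _)))
                              (sumFin-+ V _ _)) ⟩
      (sumFin V (λ i → sumFin V (λ j → deg H i * Ω i j)) + sumFin V (λ i → sumFin V (λ j → deg H j * Ω i j))) * ½
        ≡⟨ cong (λ s → (sumFin V (λ i → sumFin V (λ j → deg H i * Ω i j)) + s) * ½)
             (trans (sumFin-comm V V _) (sumFin-cong V (λ i → sumFin-cong V (λ j → cong (deg H i *_) (resistance-sym i j))))) ⟩
      (Σd·Ω + Σd·Ω) * ½
        ≡⟨ solve 1 (λ x → (x :+ x) :* con ½ := x) refl Σd·Ω ⟩
      Σd·Ω
        ≡⟨ trans (sumFin-cong V (λ i → sumFin-*ˡ V (deg H i) (Ω i))) (sumFin-deg (λ i → sumFin V (Ω i))) ⟩
      sumFin E (λ e → sumFin V (Ω (a e)) + sumFin V (Ω (b e)))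
        ≡⟨ sumFin-cong E (λ e → sym (sumFin-+ V (Ω (a e)) (Ω (b e)))) ⟩
      endpointResistance Ω  ∎
      where
      open ≡-Reasoning
      Σd·Ω : ℚ
      Σd·Ω = sumFin V (λ i → sumFin V (λ j → deg H i * Ω i j))

    KfMul≡½totalEdgeResistance : KfMul H Ω ≡ totalEdgeResistance Ω * ½
    KfMul≡½totalEdgeResistance = begin
      KfMul H Ω
        ≡⟨ pairSum-half V (λ i j → deg H i * deg H j * Ω i j)
             (λ i j → cong₂ _*_ (*-comm (deg H j) (deg H i)) (resistance-sym i j))
             (λ i → trans (cong (deg H i * deg H i *_) (resistance-diag i)) (*-zeroʳ (deg H i * deg H i))) ⟩
      sumFin V (λ i → sumFin V (λ j → deg H i * deg H j * Ω i j)) * ½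
        ≡⟨ cong (_* ½) (sumFin-cong V (λ i → trans (sumFin-cong V (λ j → *-assoc (deg H i) (deg H j) (Ω i j)))
                                                  (sumFin-*ˡ V (deg H i) _))) ⟩
      sumFin V (λ i → deg H i * sumFin V (λ j → deg H j * Ω i j)) * ½
        ≡⟨ cong (_* ½) (trans (sumFin-cong V (λ i → cong (deg H i *_) (sumFin-deg (Ω i))))
                              (sumFin-deg (λ i → sumFin E (λ f → Ω i (a f) + Ω i (b f))))) ⟩
      sumFin E (λ e → sumFin E (λ f → Ω (a e) (a f) + Ω (a e) (b f)) + sumFin E (λ f → Ω (b e) (a f) + Ω (b e) (b f))) * ½
        ≡⟨ cong (_* ½) (sumFin-cong E (λ e → trans (sym (sumFin-+ E _ _)) (sumFin-cong E (λ f →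
             solve 4 (λ w x y z → (w :+ x) :+ (y :+ z) := w :+ x :+ y :+ z) refl
               (Ω (a e) (a f)) (Ω (a e) (b f)) (Ω (b e) (a f)) (Ω (b e) (b f)))))) ⟩
      totalEdgeResistance Ω * ½  ∎
      where open ≡-Reasoning

  Kf-unique : ∀ {Ω Ω′ : PairFn H} → IsResistanceDistance H Ω → IsResistanceDistance H Ω′ → Kf H Ω ≡ Kf H Ω′
  Kf-unique isRD isRD′ = pairSum-cong V (λ i j → IsResistance-unique (isRD i j) (isRD′ i j))

-- The subdivision S H and its resistance distance

module _ (H : Graph) where

  private
    V = n H
    E = m H
    a = end₁ H
    b = end₂ H
    L = laplacian H
    LS = laplacian (S H)

  old : Fin V → Fin (n (S H))
  old u = u ↑ˡ E

  mid : Fin E → Fin (n (S H))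
  mid e = V ↑ʳ e

  edge-S-↑ˡ : ∀ e → edge (S H) (e ↑ˡ E) ≡ (old (a e) , mid e)
  edge-S-↑ˡ e rewrite Fin.splitAt-↑ˡ E e E = refl

  edge-S-↑ʳ : ∀ e → edge (S H) (E ↑ʳ e) ≡ (mid e , old (b e))
  edge-S-↑ʳ e rewrite Fin.splitAt-↑ʳ E E e = refl

  S-vertex-elim : ∀ {P : Fin (n (S H)) → Set} → (∀ u → P (old u)) → (∀ e → P (mid e)) → ∀ p → P p
  S-vertex-elim {P} P-old P-mid p = subst P (Fin.join-splitAt V E p) (P-join (splitAt V p))
    where
    P-join : ∀ s → P (Fin.join V E s)
    P-join (inj₁ u) = P-old u
    P-join (inj₂ e) = P-mid e

  sumFin-S-vertices : ∀ (F : Fin (n (S H)) → ℚ) → sumFin (n (S H)) F ≡ sumFin V (F ∘ old) + sumFin E (F ∘ mid)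
  sumFin-S-vertices = sumFin-↑ V E

  sumFin-S-edges : ∀ (F : Fin (n (S H)) → Fin (n (S H)) → ℚ) →
    sumFin (m (S H)) (λ i → F (proj₁ (edge (S H) i)) (proj₂ (edge (S H) i)))
      ≡ sumFin E (λ e → F (old (a e)) (mid e) + F (mid e) (old (b e)))
  sumFin-S-edges F = trans (sumFin-↑ E E _) (trans
    (cong₂ _+_ (sumFin-cong E (λ e → cong (λ p → F (proj₁ p) (proj₂ p)) (edge-S-↑ˡ e)))
               (sumFin-cong E (λ e → cong (λ p → F (proj₁ p) (proj₂ p)) (edge-S-↑ʳ e))))
    (sym (sumFin-+ E _ _)))

  δ-old-old : ∀ u v → δ (old u) (old v) ≡ δ u v
  δ-old-old = δ-injective (Fin.↑ˡ-injective E _ _)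

  δ-mid-mid : ∀ e f → δ (mid e) (mid f) ≡ δ e f
  δ-mid-mid = δ-injective (Fin.↑ʳ-injective V _ _)

  old≢mid : ∀ u e → old u ≢ mid e
  old≢mid u e old≡mid = ℕ.<⇒≢ (ℕ.<-≤-trans (Fin.toℕ<n u) (ℕ.m≤m+n V (toℕ e)))
    (trans (sym (Fin.toℕ-↑ˡ u E)) (trans (cong toℕ old≡mid) (Fin.toℕ-↑ʳ V e)))

  δ-old-mid : ∀ u e → δ (old u) (mid e) ≡ 0ℚ
  δ-old-mid u e = δ-≢ (old≢mid u e)

  δ-mid-old : ∀ e u → δ (mid e) (old u) ≡ 0ℚ
  δ-mid-old e u = δ-≢ (old≢mid u e ∘ sym)

  lift : (Fin V → ℚ) → (Fin E → ℚ) → Fin (n (S H)) → ℚ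
  lift X t p = [ X , (λ e → (X (a e) + X (b e)) * ½ + t e) ]′ (splitAt V p)

  lift-old : ∀ X t u → lift X t (old u) ≡ X u
  lift-old X t u rewrite Fin.splitAt-↑ˡ V u E = refl

  lift-mid : ∀ X t e → lift X t (mid e) ≡ (X (a e) + X (b e)) * ½ + t e
  lift-mid X t e rewrite Fin.splitAt-↑ʳ V E e = refl

  laplacian-lift-old : ∀ X t w → LS (lift X t) (old w) ≡ L X w * ½ - sumFin E (λ e → (δ (a e) w + δ (b e) w) * t e)
  laplacian-lift-old X t w = begin
    LS (lift X t) (old w)
      ≡⟨ sumFin-S-edges (λ p q → (δ p (old w) - δ q (old w)) * (lift X t p - lift X t q)) ⟩
    sumFin E (λ e → (δ (old (a e)) (old w) - δ (mid e) (old w)) * (lift X t (old (a e)) - lift X t (mid e))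
                  + (δ (mid e) (old w) - δ (old (b e)) (old w)) * (lift X t (mid e) - lift X t (old (b e))))
      ≡⟨ sumFin-cong E edge-term ⟩
    sumFin E (λ e → (δ (a e) w - δ (b e) w) * (X (a e) - X (b e)) * ½ - (δ (a e) w + δ (b e) w) * t e)
      ≡⟨ trans (sumFin-- E _ _) (cong (_- sumFin E (λ e → (δ (a e) w + δ (b e) w) * t e)) (sumFin-*ʳ E ½ _)) ⟩
    L X w * ½ - sumFin E (λ e → (δ (a e) w + δ (b e) w) * t e)  ∎
    where
    open ≡-Reasoning
    edge-term : ∀ e → (δ (old (a e)) (old w) - δ (mid e) (old w)) * (lift X t (old (a e)) - lift X t (mid e))
                      + (δ (mid e) (old w) - δ (old (b e)) (old w)) * (lift X t (mid e) - lift X t (old (b e)))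
                    ≡ (δ (a e) w - δ (b e) w) * (X (a e) - X (b e)) * ½ - (δ (a e) w + δ (b e) w) * t e
    edge-term e rewrite δ-old-old (a e) w | δ-old-old (b e) w | δ-mid-old e w
                      | lift-old X t (a e) | lift-old X t (b e) | lift-mid X t e =
      solve 5 (λ p q xa xb te → (p :- con 0ℚ) :* (xa :- ((xa :+ xb) :* con ½ :+ te))
                                 :+ (con 0ℚ :- q) :* ((xa :+ xb) :* con ½ :+ te :- xb)
                               := (p :- q) :* (xa :- xb) :* con ½ :- (p :+ q) :* te)
        refl (δ (a e) w) (δ (b e) w) (X (a e)) (X (b e)) (t e)

  laplacian-lift-mid : ∀ X t f → LS (lift X t) (mid f) ≡ t f + t f
  laplacian-lift-mid X t f = begin
    LS (lift X t) (mid f)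
      ≡⟨ sumFin-S-edges (λ p q → (δ p (mid f) - δ q (mid f)) * (lift X t p - lift X t q)) ⟩
    sumFin E (λ e → (δ (old (a e)) (mid f) - δ (mid e) (mid f)) * (lift X t (old (a e)) - lift X t (mid e))
                  + (δ (mid e) (mid f) - δ (old (b e)) (mid f)) * (lift X t (mid e) - lift X t (old (b e))))
      ≡⟨ sumFin-cong E edge-term ⟩
    sumFin E (λ e → (t e + t e) * δ e f)
      ≡⟨ sumFin-δʳ E f (λ e → t e + t e) ⟩
    t f + t f  ∎
    where
    open ≡-Reasoning
    edge-term : ∀ e → (δ (old (a e)) (mid f) - δ (mid e) (mid f)) * (lift X t (old (a e)) - lift X t (mid e))
                      + (δ (mid e) (mid f) - δ (old (b e)) (mid f)) * (lift X t (mid e) - lift X t (old (b e)))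
                    ≡ (t e + t e) * δ e f
    edge-term e rewrite δ-old-mid (a e) f | δ-old-mid (b e) f | δ-mid-mid e f
                      | lift-old X t (a e) | lift-old X t (b e) | lift-mid X t e =
      solve 4 (λ d xa xb te → (con 0ℚ :- d) :* (xa :- ((xa :+ xb) :* con ½ :+ te))
                               :+ (d :- con 0ℚ) :* ((xa :+ xb) :* con ½ :+ te :- xb)
                             := (te :+ te) :* d)
        refl (δ e f) (X (a e)) (X (b e)) (t e)

  -- Each edge of H becomes two unit resistors in series, so resistances between old vertices double.
  -- The other two formulas are read off the potentials lift X t constructed in the proofs below.
  module _ {Ω : PairFn H} (isRD : IsResistanceDistance H Ω) where

    Ω-mid-old : Fin E → Fin V → ℚ
    Ω-mid-old e v = Ω (a e) v + Ω (b e) v - Ω (a e) (b e) * ½ + ½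

    Ω-mid-mid : Fin E → Fin E → ℚ
    Ω-mid-mid e f = edgeResistance H Ω e f * ½ - Ω (a e) (b e) * ½ - Ω (a f) (b f) * ½ + 1ℚ - δ e f

    ΩS : PairFn (S H)
    ΩS p q = [ (λ u → [ (λ v → Ω u v + Ω u v) , (λ f → Ω-mid-old f u) ]′ (splitAt V q))
             , (λ e → [ Ω-mid-old e , Ω-mid-mid e ]′ (splitAt V q)) ]′ (splitAt V p)

    ΩS-old-old : ∀ u v → ΩS (old u) (old v) ≡ Ω u v + Ω u v
    ΩS-old-old u v rewrite Fin.splitAt-↑ˡ V u E | Fin.splitAt-↑ˡ V v E = refl

    ΩS-old-mid : ∀ u f → ΩS (old u) (mid f) ≡ Ω-mid-old f u
    ΩS-old-mid u f rewrite Fin.splitAt-↑ˡ V u E | Fin.splitAt-↑ʳ V E f = refl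

    ΩS-mid-old : ∀ e v → ΩS (mid e) (old v) ≡ Ω-mid-old e v
    ΩS-mid-old e v rewrite Fin.splitAt-↑ʳ V E e | Fin.splitAt-↑ˡ V v E = refl

    ΩS-mid-mid : ∀ e f → ΩS (mid e) (mid f) ≡ Ω-mid-mid e f
    ΩS-mid-mid e f rewrite Fin.splitAt-↑ʳ V E e | Fin.splitAt-↑ʳ V E f = refl

    private
      P = potential H isRD
      LP = laplacian-potential H isRD
      Ω≡P = resistance≡potential H isRD
      P≡Ω = potential-from-resistances H isRD
      Ω-sym = resistance-sym H isRD

      sumFin-incidence-δ : ∀ w c e → sumFin E (λ g → (δ (a g) w + δ (b g) w) * (c * δ e g)) ≡ c * (δ (a e) w + δ (b e) w)
      sumFin-incidence-δ w c e = trans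
        (sumFin-cong E (λ g → trans (solve 3 (λ F c d → F :* (c :* d) := c :* F :* d) refl (δ (a g) w + δ (b g) w) c (δ e g))
                                    (cong (c * (δ (a g) w + δ (b g) w) *_) (δ-sym e g))))
        (sumFin-δʳ E e (λ g → c * (δ (a g) w + δ (b g) w)))

    isResistance-old-old : ∀ u v → IsResistance (S H) (old u) (old v) (Ω u v + Ω u v)
    isResistance-old-old u v = Z , S-vertex-elim at-old at-mid , value
      where
      X : Fin V → ℚ
      X w = P u v w + P u v w
      Z = lift X (λ _ → 0ℚ)
      at-old : ∀ w → LS Z (old w) ≡ δ (old u) (old w) - δ (old v) (old w)
      at-old w = begin
        LS Z (old w)
          ≡⟨ laplacian-lift-old X (λ _ → 0ℚ) w ⟩
        L X w * ½ - sumFin E (λ e → (δ (a e) w + δ (b e) w) * 0ℚ)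
          ≡⟨ cong₂ (λ l s → l * ½ - s) (trans (laplacian-+ H (P u v) (P u v) w) (cong₂ _+_ (LP u v w) (LP u v w)))
                                        (trans (sumFin-cong E (λ e → *-zeroʳ (δ (a e) w + δ (b e) w))) (sumFin-zero E)) ⟩
        ((δ u w - δ v w) + (δ u w - δ v w)) * ½ - 0ℚ
          ≡⟨ solve 2 (λ p q → ((p :- q) :+ (p :- q)) :* con ½ :- con 0ℚ := p :- q) refl (δ u w) (δ v w) ⟩
        δ u w - δ v w
          ≡⟨ cong₂ _-_ (δ-old-old u w) (δ-old-old v w) ⟨
        δ (old u) (old w) - δ (old v) (old w)  ∎
        where open ≡-Reasoning
      at-mid : ∀ f → LS Z (mid f) ≡ δ (old u) (mid f) - δ (old v) (mid f)
      at-mid f = trans (laplacian-lift-mid X (λ _ → 0ℚ) f) (sym (cong₂ _-_ (δ-old-mid u f) (δ-old-mid v f)))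
      value : Ω u v + Ω u v ≡ Z (old u) - Z (old v)
      value rewrite lift-old X (λ _ → 0ℚ) u | lift-old X (λ _ → 0ℚ) v | Ω≡P u v =
        solve 2 (λ p q → (p :- q) :+ (p :- q) := (p :+ p) :- (q :+ q)) refl (P u v u) (P u v v)

    isResistance-mid-old : ∀ e v → IsResistance (S H) (mid e) (old v) (Ω-mid-old e v)
    isResistance-mid-old e v = Z , S-vertex-elim at-old at-mid , value
      where
      Pa Pb X : Fin V → ℚ
      Pa = P (a e) v
      Pb = P (b e) v
      X w = Pa w + Pb w
      t : Fin E → ℚ
      t g = ½ * δ e g
      Z = lift X t
      at-old : ∀ w → LS Z (old w) ≡ δ (mid e) (old w) - δ (old v) (old w)
      at-old w = begin
        LS Z (old w)
          ≡⟨ laplacian-lift-old X t w ⟩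
        L X w * ½ - sumFin E (λ g → (δ (a g) w + δ (b g) w) * t g)
          ≡⟨ cong₂ (λ l s → l * ½ - s) (trans (laplacian-+ H Pa Pb w) (cong₂ _+_ (LP (a e) v w) (LP (b e) v w)))
                                        (sumFin-incidence-δ w ½ e) ⟩
        ((δ (a e) w - δ v w) + (δ (b e) w - δ v w)) * ½ - ½ * (δ (a e) w + δ (b e) w)
          ≡⟨ solve 3 (λ p q r → ((p :- r) :+ (q :- r)) :* con ½ :- con ½ :* (p :+ q) := con 0ℚ :- r)
               refl (δ (a e) w) (δ (b e) w) (δ v w) ⟩
        0ℚ - δ v w
          ≡⟨ cong₂ _-_ (δ-mid-old e w) (δ-old-old v w) ⟨
        δ (mid e) (old w) - δ (old v) (old w)  ∎
        where open ≡-Reasoning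
      at-mid : ∀ f → LS Z (mid f) ≡ δ (mid e) (mid f) - δ (old v) (mid f)
      at-mid f = trans (laplacian-lift-mid X t f)
        (trans (solve 1 (λ d → con ½ :* d :+ con ½ :* d := d :- con 0ℚ) refl (δ e f))
               (sym (cong₂ _-_ (δ-mid-mid e f) (δ-old-mid v f))))
      value : Ω-mid-old e v ≡ Z (mid e) - Z (old v)
      value = sym (begin
        Z (mid e) - Z (old v)
          ≡⟨ cong₂ _-_ (lift-mid X t e) (lift-old X t v) ⟩
        (X (a e) + X (b e)) * ½ + ½ * δ e e - X v
          ≡⟨ solve 7 (λ aa ab av ba bb bv d → ((aa :+ ba) :+ (ab :+ bb)) :* con ½ :+ con ½ :* d :- (av :+ bv)
                                              := ((aa :- av) :+ (ab :- av) :+ (ba :- bv) :+ (bb :- bv)) :* con ½ :+ con ½ :* d)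
               refl (Pa (a e)) (Pa (b e)) (Pa v) (Pb (a e)) (Pb (b e)) (Pb v) (δ e e) ⟩
        ((Pa (a e) - Pa v) + (Pa (b e) - Pa v) + (Pb (a e) - Pb v) + (Pb (b e) - Pb v)) * ½ + ½ * δ e e
          ≡⟨ cong₂ (λ s d → s * ½ + ½ * d)
               (cong₂ _+_ (cong₂ _+_ (cong₂ _+_ (sym (Ω≡P (a e) v)) (P≡Ω (a e) v (b e))) (P≡Ω (b e) v (a e)))
                          (sym (Ω≡P (b e) v)))
               (δ-refl e) ⟩
        (Ω (a e) v + (Ω (a e) v + Ω (b e) v - Ω (a e) (b e)) * ½ + (Ω (b e) v + Ω (a e) v - Ω (b e) (a e)) * ½
          + Ω (b e) v) * ½ + ½ * 1ℚ
          ≡⟨ cong (λ r → (Ω (a e) v + (Ω (a e) v + Ω (b e) v - Ω (a e) (b e)) * ½ + (Ω (b e) v + Ω (a e) v - r) * ½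
                          + Ω (b e) v) * ½ + ½ * 1ℚ) (Ω-sym (a e) (b e)) ⟩
        (Ω (a e) v + (Ω (a e) v + Ω (b e) v - Ω (a e) (b e)) * ½ + (Ω (b e) v + Ω (a e) v - Ω (a e) (b e)) * ½
          + Ω (b e) v) * ½ + ½ * 1ℚ
          ≡⟨ solve 3 (λ x y z → (x :+ (x :+ y :- z) :* con ½ :+ (y :+ x :- z) :* con ½ :+ y) :* con ½ :+ con ½ :* con 1ℚ
                                 := x :+ y :- z :* con ½ :+ con ½)
               refl (Ω (a e) v) (Ω (b e) v) (Ω (a e) (b e)) ⟩
        Ω-mid-old e v  ∎)
        where open ≡-Reasoning

    isResistance-mid-mid : ∀ e f → IsResistance (S H) (mid e) (mid f) (Ω-mid-mid e f)
    isResistance-mid-mid e f = Z , S-vertex-elim at-old at-mid , value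
      where
      Pac Pbd X : Fin V → ℚ
      Pac = P (a e) (a f)
      Pbd = P (b e) (b f)
      X w = Pac w + Pbd w
      t : Fin E → ℚ
      t g = ½ * δ e g - ½ * δ f g
      Z = lift X t
      at-old : ∀ w → LS Z (old w) ≡ δ (mid e) (old w) - δ (mid f) (old w)
      at-old w = begin
        LS Z (old w)
          ≡⟨ laplacian-lift-old X t w ⟩
        L X w * ½ - sumFin E (λ g → I g * t g)
          ≡⟨ cong₂ (λ l s → l * ½ - s) (trans (laplacian-+ H Pac Pbd w) (cong₂ _+_ (LP (a e) (a f) w) (LP (b e) (b f) w)))
               (trans (sumFin-cong E (λ g → solve 4 (λ F h x y → F :* (h :* x :- h :* y) := F :* (h :* x) :- F :* (h :* y))
                                                     refl (I g) ½ (δ e g) (δ f g)))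
               (trans (sumFin-- E _ _) (cong₂ _-_ (sumFin-incidence-δ w ½ e) (sumFin-incidence-δ w ½ f)))) ⟩
        ((δ (a e) w - δ (a f) w) + (δ (b e) w - δ (b f) w)) * ½ - (½ * I e - ½ * I f)
          ≡⟨ solve 4 (λ p q r s → ((p :- r) :+ (q :- s)) :* con ½ :- (con ½ :* (p :+ q) :- con ½ :* (r :+ s)) := con 0ℚ :- con 0ℚ)
               refl (δ (a e) w) (δ (b e) w) (δ (a f) w) (δ (b f) w) ⟩
        0ℚ - 0ℚ
          ≡⟨ cong₂ _-_ (δ-mid-old e w) (δ-mid-old f w) ⟨
        δ (mid e) (old w) - δ (mid f) (old w)  ∎
        where
        open ≡-Reasoning
        I : Fin E → ℚ
        I g = δ (a g) w + δ (b g) w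
      at-mid : ∀ h → LS Z (mid h) ≡ δ (mid e) (mid h) - δ (mid f) (mid h)
      at-mid h = trans (laplacian-lift-mid X t h)
        (trans (solve 2 (λ x y → (con ½ :* x :- con ½ :* y) :+ (con ½ :* x :- con ½ :* y) := x :- y) refl (δ e h) (δ f h))
               (sym (cong₂ _-_ (δ-mid-mid e h) (δ-mid-mid f h))))
      value : Ω-mid-mid e f ≡ Z (mid e) - Z (mid f)
      value = sym (begin
        Z (mid e) - Z (mid f)
          ≡⟨ cong₂ _-_ (lift-mid X t e) (lift-mid X t f) ⟩
        ((X (a e) + X (b e)) * ½ + t e) - ((X (a f) + X (b f)) * ½ + t f)
          ≡⟨ solve 10 (λ pa pb pc pd qa qb qc qd te tf →
                 ((pa :+ qa) :+ (pb :+ qb)) :* con ½ :+ te :- (((pc :+ qc) :+ (pd :+ qd)) :* con ½ :+ tf)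
              := ((pa :- pc) :+ (pb :- pc) :- (pd :- pc) :+ (qa :- qd) :+ (qb :- qd) :- (qc :- qd)) :* con ½ :+ (te :- tf))
               refl (Pac (a e)) (Pac (b e)) (Pac (a f)) (Pac (b f)) (Pbd (a e)) (Pbd (b e)) (Pbd (a f)) (Pbd (b f)) (t e) (t f) ⟩
        ((Pac (a e) - Pac (a f)) + (Pac (b e) - Pac (a f)) - (Pac (b f) - Pac (a f))
          + (Pbd (a e) - Pbd (b f)) + (Pbd (b e) - Pbd (b f)) - (Pbd (a f) - Pbd (b f))) * ½ + (t e - t f)
          ≡⟨ cong₂ (λ s r → s * ½ + r)
               (cong₂ _-_ (cong₂ _+_ (cong₂ _+_ (cong₂ _-_ (cong₂ _+_ (sym (Ω≡P (a e) (a f))) (P≡Ω (a e) (a f) (b e)))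
                                                           (P≡Ω (a e) (a f) (b f)))
                                                (P≡Ω (b e) (b f) (a e)))
                                     (sym (Ω≡P (b e) (b f))))
                          (P≡Ω (b e) (b f) (a f)))
               (cong₂ (λ x y → (½ * x - ½ * y) - (½ * δ e f - ½ * δ f f)) (δ-refl e) (δ-sym f e)) ⟩
        (ac + (ac + bc - ab) * ½ - (ac + Ω (b f) (a f) - ad) * ½ + (bd + ad - Ω (b e) (a e)) * ½ + bd - (bd + cd - bc) * ½) * ½
          + ((½ * 1ℚ - ½ * δ e f) - (½ * δ e f - ½ * δ f f))
          ≡⟨ cong₃ (λ x y z → (ac + (ac + bc - ab) * ½ - (ac + x - ad) * ½ + (bd + ad - y) * ½ + bd - (bd + cd - bc) * ½) * ½
                              + ((½ * 1ℚ - ½ * δ e f) - (½ * δ e f - ½ * z)))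
               (Ω-sym (a f) (b f)) (Ω-sym (a e) (b e)) (δ-refl f) ⟩
        (ac + (ac + bc - ab) * ½ - (ac + cd - ad) * ½ + (bd + ad - ab) * ½ + bd - (bd + cd - bc) * ½) * ½
          + ((½ * 1ℚ - ½ * δ e f) - (½ * δ e f - ½ * 1ℚ))
          ≡⟨ solve 7 (λ ac ad bc bd ab cd d →
                 (ac :+ (ac :+ bc :- ab) :* con ½ :- (ac :+ cd :- ad) :* con ½ :+ (bd :+ ad :- ab) :* con ½ :+ bd
                   :- (bd :+ cd :- bc) :* con ½) :* con ½ :+ ((con ½ :* con 1ℚ :- con ½ :* d) :- (con ½ :* d :- con ½ :* con 1ℚ))
              := (ac :+ ad :+ bc :+ bd) :* con ½ :- ab :* con ½ :- cd :* con ½ :+ con 1ℚ :- d)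
               refl ac ad bc bd ab cd (δ e f) ⟩
        Ω-mid-mid e f  ∎)
        where
        open ≡-Reasoning
        ac ad bc bd ab cd : ℚ
        ac = Ω (a e) (a f)
        ad = Ω (a e) (b f)
        bc = Ω (b e) (a f)
        bd = Ω (b e) (b f)
        ab = Ω (a e) (b e)
        cd = Ω (a f) (b f)

    ΩS-isResistanceDistance : IsResistanceDistance (S H) ΩS
    ΩS-isResistanceDistance = S-vertex-elim
      (λ u → S-vertex-elim
        (λ v → subst (IsResistance (S H) (old u) (old v)) (sym (ΩS-old-old u v)) (isResistance-old-old u v))
        (λ f → subst (IsResistance (S H) (old u) (mid f)) (sym (ΩS-old-mid u f))
                     (IsResistance-flip (S H) (isResistance-mid-old f u))))
      (λ e → S-vertex-elim
        (λ v → subst (IsResistance (S H) (mid e) (old v)) (sym (ΩS-mid-old e v)) (isResistance-mid-old e v))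
        (λ f → subst (IsResistance (S H) (mid e) (mid f)) (sym (ΩS-mid-mid e f)) (isResistance-mid-mid e f)))

    private
      ν μ T : ℚ
      ν = ℕ→ℚ V
      μ = ℕ→ℚ E
      T = sumFin E (λ e → Ω (a e) (b e))

    sum-Ω-mid-old : sumFin E (λ e → sumFin V (Ω-mid-old e)) ≡ endpointResistance H Ω + ν * (μ - T) * ½
    sum-Ω-mid-old = begin
      sumFin E (λ e → sumFin V (Ω-mid-old e))
        ≡⟨ sumFin-cong E (λ e → trans (sumFin-cong V (λ v →
             solve 3 (λ x y z → x :+ y :- z :* con ½ :+ con ½ := (x :+ y) :+ (con ½ :- z :* con ½))
               refl (Ω (a e) v) (Ω (b e) v) (Ω (a e) (b e))))
             (trans (sumFin-+ V _ _) (cong (_+_ (sumFin V (λ v → Ω (a e) v + Ω (b e) v))) (sumFin-const V (½ - Ω (a e) (b e) * ½))))) ⟩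
      sumFin E (λ e → sumFin V (λ v → Ω (a e) v + Ω (b e) v) + ν * (½ - Ω (a e) (b e) * ½))
        ≡⟨ trans (sumFin-+ E _ _) (cong (_+_ (endpointResistance H Ω)) (sumFin-*ˡ E ν _)) ⟩
      endpointResistance H Ω + ν * sumFin E (λ e → ½ - Ω (a e) (b e) * ½)
        ≡⟨ cong (λ s → endpointResistance H Ω + ν * s)
             (trans (sumFin-- E _ _) (cong₂ _-_ (sumFin-const E ½) (sumFin-*ʳ E ½ _))) ⟩
      endpointResistance H Ω + ν * (μ * ½ - T * ½)
        ≡⟨ cong (_+_ (endpointResistance H Ω)) (solve 3 (λ n m t → n :* (m :* con ½ :- t :* con ½) := n :* (m :- t) :* con ½) refl ν μ T) ⟩
      endpointResistance H Ω + ν * (μ - T) * ½  ∎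
      where open ≡-Reasoning

    sum-Ω-mid-mid : sumFin E (λ e → sumFin E (Ω-mid-mid e)) ≡ totalEdgeResistance H Ω * ½ - μ * T + μ * μ - μ
    sum-Ω-mid-mid = begin
      sumFin E (λ e → sumFin E (Ω-mid-mid e))
        ≡⟨ sumFin-cong E (λ e → trans (sumFin-cong E (λ f →
             solve 4 (λ c x y d → c :* con ½ :- x :* con ½ :- y :* con ½ :+ con 1ℚ :- d
                                 := (c :* con ½ :- y :* con ½ :- d) :+ (con 1ℚ :- x :* con ½)) refl
               (edgeResistance H Ω e f) (Ω (a e) (b e)) (Ω (a f) (b f)) (δ e f)))
             (trans (sumFin-+ E _ _) (cong₂ _+_
               (trans (sumFin-- E _ _) (cong₂ _-_ (trans (sumFin-- E _ _) (cong₂ _-_ (sumFin-*ʳ E ½ _) (sumFin-*ʳ E ½ _)))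
                                                  (sumFin-δ-one E e)))
               (sumFin-const E _)))) ⟩
      sumFin E (λ e → (sumFin E (edgeResistance H Ω e) * ½ - T * ½ - 1ℚ) + μ * (1ℚ - Ω (a e) (b e) * ½))
        ≡⟨ trans (sumFin-+ E _ _) (cong₂ _+_
             (trans (sumFin-- E _ _) (cong₂ _-_ (trans (sumFin-- E _ _) (cong₂ _-_ (sumFin-*ʳ E ½ _) (sumFin-const E _)))
                                                (sumFin-const E 1ℚ)))
             (trans (sumFin-*ˡ E μ _) (cong (μ *_) (trans (sumFin-- E _ _) (cong₂ _-_ (sumFin-const E 1ℚ) (sumFin-*ʳ E ½ _)))))) ⟩
      (totalEdgeResistance H Ω * ½ - μ * (T * ½) - μ * 1ℚ) + μ * (μ * 1ℚ - T * ½)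
        ≡⟨ solve 3 (λ c m t → (c :* con ½ :- m :* (t :* con ½) :- m :* con 1ℚ) :+ m :* (m :* con 1ℚ :- t :* con ½)
                              := c :* con ½ :- m :* t :+ m :* m :- m) refl (totalEdgeResistance H Ω) μ T ⟩
      totalEdgeResistance H Ω * ½ - μ * T + μ * μ - μ  ∎
      where open ≡-Reasoning

    sum-Ω-mid-old-endpoints :
      sumFin E (λ e → sumFin E (λ f → Ω-mid-old f (a e) + Ω-mid-old f (b e))) ≡ totalEdgeResistance H Ω - μ * T + μ * μ
    sum-Ω-mid-old-endpoints = begin
      sumFin E (λ e → sumFin E (λ f → Ω-mid-old f (a e) + Ω-mid-old f (b e)))
        ≡⟨ sumFin-cong E (λ e → trans (sumFin-cong E (endpoints e))
             (trans (sumFin-+ E _ _) (cong₂ _+_ (sumFin-- E _ _) (sumFin-const E 1ℚ)))) ⟩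
      sumFin E (λ e → sumFin E (edgeResistance H Ω e) - T + μ * 1ℚ)
        ≡⟨ trans (sumFin-+ E _ (λ _ → μ * 1ℚ)) (cong₂ _+_ (trans (sumFin-- E _ (λ _ → T)) (cong (_-_ (totalEdgeResistance H Ω)) (sumFin-const E T)))
                                                 (sumFin-const E (μ * 1ℚ))) ⟩
      totalEdgeResistance H Ω - μ * T + μ * (μ * 1ℚ)
        ≡⟨ cong (λ x → totalEdgeResistance H Ω - μ * T + μ * x) (*-identityʳ μ) ⟩
      totalEdgeResistance H Ω - μ * T + μ * μ  ∎
      where
      open ≡-Reasoning
      endpoints : ∀ e f → Ω-mid-old f (a e) + Ω-mid-old f (b e) ≡ edgeResistance H Ω e f - Ω (a f) (b f) + 1ℚ
      endpoints e f = trans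
        (cong₂ (λ x y → x + y)
           (cong₂ (λ p q → p + q - Ω (a f) (b f) * ½ + ½) (Ω-sym (a e) (a f)) (Ω-sym (a e) (b f)))
           (cong₂ (λ p q → p + q - Ω (a f) (b f) * ½ + ½) (Ω-sym (b e) (a f)) (Ω-sym (b e) (b f))))
        (solve 5 (λ ac ad bc bd cd → (ac :+ ad :- cd :* con ½ :+ con ½) :+ (bc :+ bd :- cd :* con ½ :+ con ½)
                                    := ac :+ ad :+ bc :+ bd :- cd :+ con 1ℚ)
           refl (Ω (a e) (a f)) (Ω (a e) (b f)) (Ω (b e) (a f)) (Ω (b e) (b f)) (Ω (a f) (b f)))

    private
      A B C R K M : ℚ
      A = totalResistance H Ω
      B = endpointResistance H Ω
      C = totalEdgeResistance H Ω
      R = sumFin E (λ e → sumFin V (Ω-mid-old e))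
      K = sumFin E (λ e → sumFin E (Ω-mid-mid e))
      M = sumFin E (λ e → sumFin E (λ f → Ω-mid-old f (a e) + Ω-mid-old f (b e)))

      row-old : ∀ u → sumFin (n (S H)) (ΩS (old u)) ≡ (sumFin V (Ω u) + sumFin V (Ω u)) + sumFin E (λ f → Ω-mid-old f u)
      row-old u = trans (sumFin-S-vertices (ΩS (old u)))
        (cong₂ _+_ (trans (sumFin-cong V (ΩS-old-old u)) (sumFin-+ V (Ω u) (Ω u))) (sumFin-cong E (ΩS-old-mid u)))

      row-mid : ∀ e → sumFin (n (S H)) (ΩS (mid e)) ≡ sumFin V (Ω-mid-old e) + sumFin E (Ω-mid-mid e)
      row-mid e = trans (sumFin-S-vertices (ΩS (mid e)))
        (cong₂ _+_ (sumFin-cong V (ΩS-mid-old e)) (sumFin-cong E (ΩS-mid-mid e)))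

    totalResistance-S : totalResistance (S H) ΩS ≡ (A + A) + R + (R + K)
    totalResistance-S = begin
      totalResistance (S H) ΩS
        ≡⟨ sumFin-S-vertices _ ⟩
      sumFin V (λ u → sumFin (n (S H)) (ΩS (old u))) + sumFin E (λ e → sumFin (n (S H)) (ΩS (mid e)))
        ≡⟨ cong₂ _+_ (trans (sumFin-cong V row-old) (sumFin-+ V _ _)) (trans (sumFin-cong E row-mid) (sumFin-+ E _ _)) ⟩
      sumFin V (λ u → sumFin V (Ω u) + sumFin V (Ω u)) + sumFin V (λ u → sumFin E (λ f → Ω-mid-old f u)) + (R + K)
        ≡⟨ cong₂ (λ x y → x + y + (R + K)) (sumFin-+ V _ _) (sumFin-comm V E _) ⟩
      (A + A) + R + (R + K)  ∎
      where open ≡-Reasoning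

    endpointResistance-S : endpointResistance (S H) ΩS ≡ (B + B) + M + ((R + K) + (R + K))
    endpointResistance-S = begin
      endpointResistance (S H) ΩS
        ≡⟨ sumFin-S-edges (λ p q → sumFin (n (S H)) (λ r → ΩS p r + ΩS q r)) ⟩
      sumFin E (λ e → rows (old (a e)) (mid e) + rows (mid e) (old (b e)))
        ≡⟨ sumFin-cong E per-edge ⟩
      sumFin E (λ e → (Bₑ e + Bₑ e) + Mₑ e + ((Rₑ e + Kₑ e) + (Rₑ e + Kₑ e)))
        ≡⟨ trans (sumFin-+ E _ _) (cong₂ _+_ (trans (sumFin-+ E _ _) (cong (_+ M) (sumFin-+ E Bₑ Bₑ)))
                                             (trans (sumFin-+ E _ _) (cong₂ _+_ (sumFin-+ E Rₑ Kₑ) (sumFin-+ E Rₑ Kₑ)))) ⟩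
      (B + B) + M + ((R + K) + (R + K))  ∎
      where
      open ≡-Reasoning
      rows : Fin (n (S H)) → Fin (n (S H)) → ℚ
      rows p q = sumFin (n (S H)) (λ r → ΩS p r + ΩS q r)
      Bₑ Mₑ Rₑ Kₑ : Fin E → ℚ
      Bₑ e = sumFin V (λ v → Ω (a e) v + Ω (b e) v)
      Mₑ e = sumFin E (λ f → Ω-mid-old f (a e) + Ω-mid-old f (b e))
      Rₑ e = sumFin V (Ω-mid-old e)
      Kₑ e = sumFin E (Ω-mid-mid e)
      per-edge : ∀ e → rows (old (a e)) (mid e) + rows (mid e) (old (b e))
                       ≡ (Bₑ e + Bₑ e) + Mₑ e + ((Rₑ e + Kₑ e) + (Rₑ e + Kₑ e))
      per-edge e = begin
        rows (old (a e)) (mid e) + rows (mid e) (old (b e))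
          ≡⟨ cong₂ _+_ (trans (sumFin-+ (n (S H)) (ΩS (old (a e))) (ΩS (mid e))) (cong₂ _+_ (row-old (a e)) (row-mid e)))
                       (trans (sumFin-+ (n (S H)) (ΩS (mid e)) (ΩS (old (b e)))) (cong₂ _+_ (row-mid e) (row-old (b e)))) ⟩
        ((Ωa + Ωa) + ρa + (Rₑ e + Kₑ e)) + ((Rₑ e + Kₑ e) + ((Ωb + Ωb) + ρb))
          ≡⟨ solve 5 (λ x y p q r → ((x :+ x) :+ p :+ r) :+ (r :+ ((y :+ y) :+ q)) := ((x :+ y) :+ (x :+ y)) :+ (p :+ q) :+ (r :+ r))
               refl Ωa Ωb ρa ρb (Rₑ e + Kₑ e) ⟩
        ((Ωa + Ωb) + (Ωa + Ωb)) + (ρa + ρb) + ((Rₑ e + Kₑ e) + (Rₑ e + Kₑ e))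
          ≡⟨ cong₂ (λ x y → (x + x) + y + ((Rₑ e + Kₑ e) + (Rₑ e + Kₑ e))) (sym (sumFin-+ V _ _)) (sym (sumFin-+ E _ _)) ⟩
        (Bₑ e + Bₑ e) + Mₑ e + ((Rₑ e + Kₑ e) + (Rₑ e + Kₑ e))  ∎
        where
        Ωa Ωb ρa ρb : ℚ
        Ωa = sumFin V (Ω (a e))
        Ωb = sumFin V (Ω (b e))
        ρa = sumFin E (λ f → Ω-mid-old f (a e))
        ρb = sumFin E (λ f → Ω-mid-old f (b e))

    totalEdgeResistance-S : totalEdgeResistance (S H) ΩS ≡ ℕ→ℚ 2 * C + ℕ→ℚ 2 * M + ℕ→ℚ 2 * M + ℕ→ℚ 4 * K
    totalEdgeResistance-S = begin
      totalEdgeResistance (S H) ΩS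
        ≡⟨ sumFin-S-edges (λ p q → sumFin (m (S H)) (λ j → G p q (proj₁ (edge (S H) j)) (proj₂ (edge (S H) j)))) ⟩
      sumFin E (λ e → sumFin (m (S H)) (λ j → G (old (a e)) (mid e) (proj₁ (edge (S H) j)) (proj₂ (edge (S H) j)))
                    + sumFin (m (S H)) (λ j → G (mid e) (old (b e)) (proj₁ (edge (S H) j)) (proj₂ (edge (S H) j))))
        ≡⟨ sumFin-cong E (λ e → trans (cong₂ _+_ (sumFin-S-edges (G (old (a e)) (mid e))) (sumFin-S-edges (G (mid e) (old (b e)))))
                                 (trans (sym (sumFin-+ E _ _)) (sumFin-cong E (per-edge-pair e)))) ⟩
      sumFin E (λ e → sumFin E (λ f → two * edgeResistance H Ω e f + two * Mₑ f e + two * Mₑ e f + four * Ω-mid-mid e f))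
        ≡⟨ trans (sumFin-cong E (λ e → sumFin-linear₄ E two two two four _ _ _ _)) (sumFin-linear₄ E two two two four _ _ _ _) ⟩
      two * C + two * M + two * sumFin E (λ e → sumFin E (Mₑ e)) + four * K
        ≡⟨ cong (λ x → two * C + two * M + two * x + four * K) (sumFin-comm E E _) ⟩
      two * C + two * M + two * M + four * K  ∎
      where
      open ≡-Reasoning
      two four : ℚ
      two = ℕ→ℚ 2
      four = ℕ→ℚ 4
      G : Fin (n (S H)) → Fin (n (S H)) → Fin (n (S H)) → Fin (n (S H)) → ℚ
      G p q r s = ΩS p r + ΩS p s + ΩS q r + ΩS q s
      Mₑ : Fin E → Fin E → ℚ
      Mₑ e f = Ω-mid-old e (a f) + Ω-mid-old e (b f)
      sumFin-linear₄ : ∀ N x y z w (f g h k : Fin N → ℚ) →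
        sumFin N (λ i → x * f i + y * g i + z * h i + w * k i) ≡ x * sumFin N f + y * sumFin N g + z * sumFin N h + w * sumFin N k
      sumFin-linear₄ N x y z w f g h k =
        trans (sumFin-+ N _ _) (cong₂ _+_ (trans (sumFin-+ N _ _) (cong₂ _+_ (trans (sumFin-+ N _ _)
          (cong₂ _+_ (sumFin-*ˡ N x f) (sumFin-*ˡ N y g))) (sumFin-*ˡ N z h))) (sumFin-*ˡ N w k))
      per-edge-pair : ∀ e f → (G (old (a e)) (mid e) (old (a f)) (mid f) + G (old (a e)) (mid e) (mid f) (old (b f)))
                             + (G (mid e) (old (b e)) (old (a f)) (mid f) + G (mid e) (old (b e)) (mid f) (old (b f)))
                            ≡ two * edgeResistance H Ω e f + two * Mₑ f e + two * Mₑ e f + four * Ω-mid-mid e f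
      per-edge-pair e f
        rewrite ΩS-old-old (a e) (a f) | ΩS-old-old (a e) (b f) | ΩS-old-old (b e) (a f) | ΩS-old-old (b e) (b f)
              | ΩS-old-mid (a e) f | ΩS-old-mid (b e) f | ΩS-mid-old e (a f) | ΩS-mid-old e (b f) | ΩS-mid-mid e f =
        solve 9 (λ ac ad bc bd fa fb ec ed k →
            ((ac :+ ac) :+ fa :+ ec :+ k :+ (fa :+ (ad :+ ad) :+ k :+ ed))
              :+ (ec :+ k :+ (bc :+ bc) :+ fb :+ (k :+ ed :+ fb :+ (bd :+ bd)))
            := con two :* (ac :+ ad :+ bc :+ bd) :+ con two :* (fa :+ fb) :+ con two :* (ec :+ ed) :+ con four :* k)
          refl (Ω (a e) (a f)) (Ω (a e) (b f)) (Ω (b e) (a f)) (Ω (b e) (b f))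
               (Ω-mid-old f (a e)) (Ω-mid-old f (b e)) (Ω-mid-old e (a f)) (Ω-mid-old e (b f)) (Ω-mid-mid e f)

    module _ (r : Fin V) where

      private
        T≡ : T ≡ ν - 1ℚ
        T≡ = foster H isRD r
        isRD-S = ΩS-isResistanceDistance
        Kf≡ = Kf≡½totalResistance H isRD
        KfAdd≡ = KfAdd≡endpointResistance H isRD
        KfMul≡ = KfMul≡½totalEdgeResistance H isRD

      Kf-S : Kf (S H) ΩS ≡ ℕ→ℚ 2 * Kf H Ω + KfAdd H Ω + KfMul H Ω * ½ + (ν * (μ - ν + 1ℚ) + μ * (μ - ν)) * ½
      Kf-S = begin
        Kf (S H) ΩS
          ≡⟨ trans (Kf≡½totalResistance (S H) isRD-S) (cong (_* ½) totalResistance-S) ⟩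
        ((A + A) + R + (R + K)) * ½
          ≡⟨ cong₂ (λ x y → ((A + A) + x + (x + y)) * ½) sum-Ω-mid-old sum-Ω-mid-mid ⟩
        ((A + A) + (B + ν * (μ - T) * ½) + ((B + ν * (μ - T) * ½) + (C * ½ - μ * T + μ * μ - μ))) * ½
          ≡⟨ cong (λ t → ((A + A) + (B + ν * (μ - t) * ½) + ((B + ν * (μ - t) * ½) + (C * ½ - μ * t + μ * μ - μ))) * ½) T≡ ⟩
        ((A + A) + (B + ν * (μ - (ν - 1ℚ)) * ½) + ((B + ν * (μ - (ν - 1ℚ)) * ½) + (C * ½ - μ * (ν - 1ℚ) + μ * μ - μ))) * ½
          ≡⟨ solve 5 (λ A B C n m →
               ((A :+ A) :+ (B :+ n :* (m :- (n :- con 1ℚ)) :* con ½)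
                 :+ ((B :+ n :* (m :- (n :- con 1ℚ)) :* con ½) :+ (C :* con ½ :- m :* (n :- con 1ℚ) :+ m :* m :- m))) :* con ½
               := con (ℕ→ℚ 2) :* (A :* con ½) :+ B :+ (C :* con ½) :* con ½ :+ (n :* (m :- n :+ con 1ℚ) :+ m :* (m :- n)) :* con ½)
               refl A B C ν μ ⟩
        ℕ→ℚ 2 * (A * ½) + B + (C * ½) * ½ + (ν * (μ - ν + 1ℚ) + μ * (μ - ν)) * ½
          ≡⟨ cong₃ (λ x y z → ℕ→ℚ 2 * x + y + z * ½ + (ν * (μ - ν + 1ℚ) + μ * (μ - ν)) * ½) Kf≡ KfAdd≡ KfMul≡ ⟨
        ℕ→ℚ 2 * Kf H Ω + KfAdd H Ω + KfMul H Ω * ½ + (ν * (μ - ν + 1ℚ) + μ * (μ - ν)) * ½  ∎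
        where open ≡-Reasoning

      KfAdd-S : KfAdd (S H) ΩS ≡ ℕ→ℚ 4 * KfAdd H Ω + ℕ→ℚ 4 * KfMul H Ω + (μ + ν) * (μ - ν + 1ℚ) + ℕ→ℚ 2 * μ * (μ - ν)
      KfAdd-S = begin
        KfAdd (S H) ΩS
          ≡⟨ trans (KfAdd≡endpointResistance (S H) isRD-S) endpointResistance-S ⟩
        (B + B) + M + ((R + K) + (R + K))
          ≡⟨ cong₃ (λ x y z → (B + B) + x + ((y + z) + (y + z))) sum-Ω-mid-old-endpoints sum-Ω-mid-old sum-Ω-mid-mid ⟩
        (B + B) + (C - μ * T + μ * μ) + (((B + ν * (μ - T) * ½) + (C * ½ - μ * T + μ * μ - μ))
                                       + ((B + ν * (μ - T) * ½) + (C * ½ - μ * T + μ * μ - μ)))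
          ≡⟨ cong (λ t → (B + B) + (C - μ * t + μ * μ) + (((B + ν * (μ - t) * ½) + (C * ½ - μ * t + μ * μ - μ))
                                                        + ((B + ν * (μ - t) * ½) + (C * ½ - μ * t + μ * μ - μ)))) T≡ ⟩
        (B + B) + (C - μ * (ν - 1ℚ) + μ * μ) + (((B + ν * (μ - (ν - 1ℚ)) * ½) + (C * ½ - μ * (ν - 1ℚ) + μ * μ - μ))
                                              + ((B + ν * (μ - (ν - 1ℚ)) * ½) + (C * ½ - μ * (ν - 1ℚ) + μ * μ - μ)))
          ≡⟨ solve 4 (λ B C n m →
               (B :+ B) :+ (C :- m :* (n :- con 1ℚ) :+ m :* m)
                 :+ (((B :+ n :* (m :- (n :- con 1ℚ)) :* con ½) :+ (C :* con ½ :- m :* (n :- con 1ℚ) :+ m :* m :- m))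
                    :+ ((B :+ n :* (m :- (n :- con 1ℚ)) :* con ½) :+ (C :* con ½ :- m :* (n :- con 1ℚ) :+ m :* m :- m)))
               := con (ℕ→ℚ 4) :* B :+ con (ℕ→ℚ 4) :* (C :* con ½) :+ (m :+ n) :* (m :- n :+ con 1ℚ) :+ con (ℕ→ℚ 2) :* m :* (m :- n))
               refl B C ν μ ⟩
        ℕ→ℚ 4 * B + ℕ→ℚ 4 * (C * ½) + (μ + ν) * (μ - ν + 1ℚ) + ℕ→ℚ 2 * μ * (μ - ν)
          ≡⟨ cong₂ (λ x y → ℕ→ℚ 4 * x + ℕ→ℚ 4 * y + (μ + ν) * (μ - ν + 1ℚ) + ℕ→ℚ 2 * μ * (μ - ν)) KfAdd≡ KfMul≡ ⟨
        ℕ→ℚ 4 * KfAdd H Ω + ℕ→ℚ 4 * KfMul H Ω + (μ + ν) * (μ - ν + 1ℚ) + ℕ→ℚ 2 * μ * (μ - ν)  ∎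
        where open ≡-Reasoning

      KfMul-S : KfMul (S H) ΩS ≡ ℕ→ℚ 8 * KfMul H Ω + ℕ→ℚ 2 * μ * (ℕ→ℚ 2 * (μ - ν) + 1ℚ)
      KfMul-S = begin
        KfMul (S H) ΩS
          ≡⟨ trans (KfMul≡½totalEdgeResistance (S H) isRD-S) (cong (_* ½) totalEdgeResistance-S) ⟩
        (ℕ→ℚ 2 * C + ℕ→ℚ 2 * M + ℕ→ℚ 2 * M + ℕ→ℚ 4 * K) * ½
          ≡⟨ cong₂ (λ x y → (ℕ→ℚ 2 * C + ℕ→ℚ 2 * x + ℕ→ℚ 2 * x + ℕ→ℚ 4 * y) * ½) sum-Ω-mid-old-endpoints sum-Ω-mid-mid ⟩
        (ℕ→ℚ 2 * C + ℕ→ℚ 2 * (C - μ * T + μ * μ) + ℕ→ℚ 2 * (C - μ * T + μ * μ) + ℕ→ℚ 4 * (C * ½ - μ * T + μ * μ - μ)) * ½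
          ≡⟨ cong (λ t → (ℕ→ℚ 2 * C + ℕ→ℚ 2 * (C - μ * t + μ * μ) + ℕ→ℚ 2 * (C - μ * t + μ * μ)
                          + ℕ→ℚ 4 * (C * ½ - μ * t + μ * μ - μ)) * ½) T≡ ⟩
        (ℕ→ℚ 2 * C + ℕ→ℚ 2 * (C - μ * (ν - 1ℚ) + μ * μ) + ℕ→ℚ 2 * (C - μ * (ν - 1ℚ) + μ * μ)
          + ℕ→ℚ 4 * (C * ½ - μ * (ν - 1ℚ) + μ * μ - μ)) * ½
          ≡⟨ solve 3 (λ C n m →
               (con (ℕ→ℚ 2) :* C :+ con (ℕ→ℚ 2) :* (C :- m :* (n :- con 1ℚ) :+ m :* m) :+ con (ℕ→ℚ 2) :* (C :- m :* (n :- con 1ℚ) :+ m :* m)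
                 :+ con (ℕ→ℚ 4) :* (C :* con ½ :- m :* (n :- con 1ℚ) :+ m :* m :- m)) :* con ½
               := con (ℕ→ℚ 8) :* (C :* con ½) :+ con (ℕ→ℚ 2) :* m :* (con (ℕ→ℚ 2) :* (m :- n) :+ con 1ℚ))
               refl C ν μ ⟩
        ℕ→ℚ 8 * (C * ½) + ℕ→ℚ 2 * μ * (ℕ→ℚ 2 * (μ - ν) + 1ℚ)
          ≡⟨ cong (λ x → ℕ→ℚ 8 * x + ℕ→ℚ 2 * μ * (ℕ→ℚ 2 * (μ - ν) + 1ℚ)) KfMul≡ ⟨
        ℕ→ℚ 8 * KfMul H Ω + ℕ→ℚ 2 * μ * (ℕ→ℚ 2 * (μ - ν) + 1ℚ)  ∎
        where open ≡-Reasoning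

-- Iterated subdivision

module _ (G : Graph) {Ω : PairFn G} (isRD : IsResistanceDistance G Ω) (r : Fin (n G)) where

  Ωᵏ : ∀ k → Σ (PairFn (Sᵏ k G)) (IsResistanceDistance (Sᵏ k G))
  Ωᵏ zero    = Ω , isRD
  Ωᵏ (suc k) = ΩS (Sᵏ k G) (proj₂ (Ωᵏ k)) , ΩS-isResistanceDistance (Sᵏ k G) (proj₂ (Ωᵏ k))

  private
    Hᵏ : ℕ → Graph
    Hᵏ k = Sᵏ k G

    isRDᵏ : ∀ k → IsResistanceDistance (Hᵏ k) (proj₁ (Ωᵏ k))
    isRDᵏ k = proj₂ (Ωᵏ k)

    rᵏ : ∀ k → Fin (n (Hᵏ k))
    rᵏ zero    = r
    rᵏ (suc k) = old (Hᵏ k) (rᵏ k)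

    α : ℕ → ℚ
    α k = ℕ→ℚ (2 ^ k)

    α-suc : ∀ k → α (suc k) ≡ ℕ→ℚ 2 * α k
    α-suc k = ℕ→ℚ-* 2 (2 ^ k)

    ν μ d a b c : ℚ
    ν = ℕ→ℚ (n G)
    μ = ℕ→ℚ (m G)
    d = μ - ν
    a = Kf G Ω
    b = KfAdd G Ω
    c = KfMul G Ω

    νᵏ μᵏ : ℕ → ℚ
    νᵏ k = ℕ→ℚ (n (Hᵏ k))
    μᵏ k = ℕ→ℚ (m (Hᵏ k))

  edges-Sᵏ : ∀ k → μᵏ k ≡ α k * μ
  edges-Sᵏ zero    = sym (*-identityˡ μ)
  edges-Sᵏ (suc k) = begin
    ℕ→ℚ (m (Hᵏ k) ℕ.+ m (Hᵏ k))   ≡⟨ ℕ→ℚ-+ (m (Hᵏ k)) (m (Hᵏ k)) ⟩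
    μᵏ k + μᵏ k                   ≡⟨ cong (λ x → x + x) (edges-Sᵏ k) ⟩
    α k * μ + α k * μ             ≡⟨ solve 2 (λ x y → x :* y :+ x :* y := con (ℕ→ℚ 2) :* x :* y) refl (α k) μ ⟩
    ℕ→ℚ 2 * α k * μ               ≡⟨ cong (_* μ) (α-suc k) ⟨
    α (suc k) * μ                 ∎
    where open ≡-Reasoning

  vertices-Sᵏ : ∀ k → νᵏ k ≡ α k * μ - d
  vertices-Sᵏ zero    = solve 2 (λ n m → n := con 1ℚ :* m :- (m :- n)) refl ν μ
  vertices-Sᵏ (suc k) = begin
    ℕ→ℚ (n (Hᵏ k) ℕ.+ m (Hᵏ k))   ≡⟨ ℕ→ℚ-+ (n (Hᵏ k)) (m (Hᵏ k)) ⟩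
    νᵏ k + μᵏ k                   ≡⟨ cong₂ _+_ (vertices-Sᵏ k) (edges-Sᵏ k) ⟩
    α k * μ - d + α k * μ         ≡⟨ solve 3 (λ x y z → x :* y :- z :+ x :* y := con (ℕ→ℚ 2) :* x :* y :- z) refl (α k) μ d ⟩
    ℕ→ℚ 2 * α k * μ - d           ≡⟨ cong (λ x → x * μ - d) (α-suc k) ⟨
    α (suc k) * μ - d             ∎
    where open ≡-Reasoning

  KfMulᶜ KfAddᶜ : ℚ → ℚ
  KfMulᶜ x = x * x * x * c + (x * x * x - x) * (+ 1 / 3) * (μ * (ℕ→ℚ 2 * d + 1ℚ))
  KfAddᶜ x = x * x * b + (x * x * x - x * x) * c + (x * x * x - x) * (+ 1 / 3) * (μ * (ℕ→ℚ 2 * d + 1ℚ))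
             - (x * x - 1ℚ) * (+ 1 / 3) * (d * (d + 1ℚ))

  -- Kfᶜ (2ᵏ) (4ᵏ) (8ᵏ) is the right-hand side of the theorem.
  Kfᶜ : ℚ → ℚ → ℚ → ℚ
  Kfᶜ x y z = x * a + (y - x) * (+ 1 / 2) * b + (z - ℕ→ℚ 2 * y + x) * (+ 1 / 4) * c
              + (z - x) * (+ 1 / 12) * (μ * (ℕ→ℚ 2 * μ - ℕ→ℚ 2 * ν + ℕ→ℚ 1))
              - (y - ℕ→ℚ 1) * (+ 1 / 6) * ((μ - ν) * (μ - ν + ℕ→ℚ 1))

  private
    -- The closed forms again, as solver expressions: the solver needs a, b, c, μ, ν as variables.
    module ClosedFormᴾ {k : ℕ} (a b c m n : Polynomial k) where
      two dᴾ : Polynomial k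
      two = con (ℕ→ℚ 2)
      dᴾ = m :- n
      KfMulᴾ KfAddᴾ : Polynomial k → Polynomial k
      KfMulᴾ x = x :* x :* x :* c :+ (x :* x :* x :- x) :* con (+ 1 / 3) :* (m :* (two :* dᴾ :+ con 1ℚ))
      KfAddᴾ x = x :* x :* b :+ (x :* x :* x :- x :* x) :* c :+ (x :* x :* x :- x) :* con (+ 1 / 3) :* (m :* (two :* dᴾ :+ con 1ℚ))
                 :- (x :* x :- con 1ℚ) :* con (+ 1 / 3) :* (dᴾ :* (dᴾ :+ con 1ℚ))
      Kfᴾ : Polynomial k → Polynomial k → Polynomial k → Polynomial k
      Kfᴾ x y z = x :* a :+ (y :- x) :* con (+ 1 / 2) :* b :+ (z :- two :* y :+ x) :* con (+ 1 / 4) :* c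
                  :+ (z :- x) :* con (+ 1 / 12) :* (m :* (two :* m :- two :* n :+ con 1ℚ))
                  :- (y :- con 1ℚ) :* con (+ 1 / 6) :* ((m :- n) :* (m :- n :+ con 1ℚ))
      Kfᴾ′ : Polynomial k → Polynomial k
      Kfᴾ′ x = Kfᴾ x (x :* x) (x :* x :* x)

    KfMulᶜ-step : ∀ x → ℕ→ℚ 8 * KfMulᶜ x + ℕ→ℚ 2 * (x * μ) * (ℕ→ℚ 2 * (x * μ - (x * μ - d)) + 1ℚ) ≡ KfMulᶜ (ℕ→ℚ 2 * x)
    KfMulᶜ-step x = solve 6 (λ x a b c m n → let open ClosedFormᴾ a b c m n in
        con (ℕ→ℚ 8) :* KfMulᴾ x :+ two :* (x :* m) :* (two :* (x :* m :- (x :* m :- dᴾ)) :+ con 1ℚ) := KfMulᴾ (two :* x))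
      refl x a b c μ ν

    KfAddᶜ-step : ∀ x → ℕ→ℚ 4 * KfAddᶜ x + ℕ→ℚ 4 * KfMulᶜ x + (x * μ + (x * μ - d)) * (x * μ - (x * μ - d) + 1ℚ)
                        + ℕ→ℚ 2 * (x * μ) * (x * μ - (x * μ - d)) ≡ KfAddᶜ (ℕ→ℚ 2 * x)
    KfAddᶜ-step x = solve 6 (λ x a b c m n → let open ClosedFormᴾ a b c m n in
        con (ℕ→ℚ 4) :* KfAddᴾ x :+ con (ℕ→ℚ 4) :* KfMulᴾ x :+ (x :* m :+ (x :* m :- dᴾ)) :* (x :* m :- (x :* m :- dᴾ) :+ con 1ℚ)
          :+ two :* (x :* m) :* (x :* m :- (x :* m :- dᴾ)) := KfAddᴾ (two :* x))
      refl x a b c μ ν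

    Kfᶜ′ : ℚ → ℚ
    Kfᶜ′ x = Kfᶜ x (x * x) (x * x * x)

    Kfᶜ-step : ∀ x → ℕ→ℚ 2 * Kfᶜ′ x + KfAddᶜ x + KfMulᶜ x * ½
                     + ((x * μ - d) * (x * μ - (x * μ - d) + 1ℚ) + x * μ * (x * μ - (x * μ - d))) * ½ ≡ Kfᶜ′ (ℕ→ℚ 2 * x)
    Kfᶜ-step x = solve 6 (λ x a b c m n → let open ClosedFormᴾ a b c m n in
        two :* Kfᴾ′ x :+ KfAddᴾ x :+ KfMulᴾ x :* con ½
          :+ ((x :* m :- dᴾ) :* (x :* m :- (x :* m :- dᴾ) :+ con 1ℚ) :+ x :* m :* (x :* m :- (x :* m :- dᴾ))) :* con ½
        := Kfᴾ′ (two :* x))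
      refl x a b c μ ν

  KfMul-Sᵏ : ∀ k → KfMul (Hᵏ k) (proj₁ (Ωᵏ k)) ≡ KfMulᶜ (α k)
  KfMul-Sᵏ zero    = solve 5 (λ a b c m n → let open ClosedFormᴾ a b c m n in c := KfMulᴾ (con 1ℚ)) refl a b c μ ν
  KfMul-Sᵏ (suc k) = begin
    KfMul (Hᵏ (suc k)) (proj₁ (Ωᵏ (suc k)))
      ≡⟨ KfMul-S (Hᵏ k) (isRDᵏ k) (rᵏ k) ⟩
    ℕ→ℚ 8 * KfMul (Hᵏ k) (proj₁ (Ωᵏ k)) + ℕ→ℚ 2 * μᵏ k * (ℕ→ℚ 2 * (μᵏ k - νᵏ k) + 1ℚ)
      ≡⟨ cong₃ (λ x y z → ℕ→ℚ 8 * x + ℕ→ℚ 2 * y * (ℕ→ℚ 2 * (y - z) + 1ℚ)) (KfMul-Sᵏ k) (edges-Sᵏ k) (vertices-Sᵏ k) ⟩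
    ℕ→ℚ 8 * KfMulᶜ (α k) + ℕ→ℚ 2 * (α k * μ) * (ℕ→ℚ 2 * (α k * μ - (α k * μ - d)) + 1ℚ)
      ≡⟨ KfMulᶜ-step (α k) ⟩
    KfMulᶜ (ℕ→ℚ 2 * α k)
      ≡⟨ cong KfMulᶜ (α-suc k) ⟨
    KfMulᶜ (α (suc k))  ∎
    where open ≡-Reasoning

  KfAdd-Sᵏ : ∀ k → KfAdd (Hᵏ k) (proj₁ (Ωᵏ k)) ≡ KfAddᶜ (α k)
  KfAdd-Sᵏ zero    = solve 5 (λ a b c m n → let open ClosedFormᴾ a b c m n in b := KfAddᴾ (con 1ℚ)) refl a b c μ ν
  KfAdd-Sᵏ (suc k) = begin
    KfAdd (Hᵏ (suc k)) (proj₁ (Ωᵏ (suc k)))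
      ≡⟨ KfAdd-S (Hᵏ k) (isRDᵏ k) (rᵏ k) ⟩
    ℕ→ℚ 4 * KfAdd (Hᵏ k) (proj₁ (Ωᵏ k)) + ℕ→ℚ 4 * KfMul (Hᵏ k) (proj₁ (Ωᵏ k))
      + (μᵏ k + νᵏ k) * (μᵏ k - νᵏ k + 1ℚ) + ℕ→ℚ 2 * μᵏ k * (μᵏ k - νᵏ k)
      ≡⟨ cong₂ (λ x y → ℕ→ℚ 4 * x + ℕ→ℚ 4 * y + (μᵏ k + νᵏ k) * (μᵏ k - νᵏ k + 1ℚ) + ℕ→ℚ 2 * μᵏ k * (μᵏ k - νᵏ k))
           (KfAdd-Sᵏ k) (KfMul-Sᵏ k) ⟩
    ℕ→ℚ 4 * KfAddᶜ (α k) + ℕ→ℚ 4 * KfMulᶜ (α k) + (μᵏ k + νᵏ k) * (μᵏ k - νᵏ k + 1ℚ) + ℕ→ℚ 2 * μᵏ k * (μᵏ k - νᵏ k)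
      ≡⟨ cong₂ (λ y z → ℕ→ℚ 4 * KfAddᶜ (α k) + ℕ→ℚ 4 * KfMulᶜ (α k) + (y + z) * (y - z + 1ℚ) + ℕ→ℚ 2 * y * (y - z))
           (edges-Sᵏ k) (vertices-Sᵏ k) ⟩
    ℕ→ℚ 4 * KfAddᶜ (α k) + ℕ→ℚ 4 * KfMulᶜ (α k) + (α k * μ + (α k * μ - d)) * (α k * μ - (α k * μ - d) + 1ℚ)
      + ℕ→ℚ 2 * (α k * μ) * (α k * μ - (α k * μ - d))
      ≡⟨ KfAddᶜ-step (α k) ⟩
    KfAddᶜ (ℕ→ℚ 2 * α k)
      ≡⟨ cong KfAddᶜ (α-suc k) ⟨
    KfAddᶜ (α (suc k))  ∎
    where open ≡-Reasoning

  Kf-Sᵏ : ∀ k → Kf (Hᵏ k) (proj₁ (Ωᵏ k)) ≡ Kfᶜ (α k) (α k * α k) (α k * α k * α k)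
  Kf-Sᵏ zero    = solve 5 (λ a b c m n → let open ClosedFormᴾ a b c m n in a := Kfᴾ′ (con 1ℚ)) refl a b c μ ν
  Kf-Sᵏ (suc k) = begin
    Kf (Hᵏ (suc k)) (proj₁ (Ωᵏ (suc k)))
      ≡⟨ Kf-S (Hᵏ k) (isRDᵏ k) (rᵏ k) ⟩
    ℕ→ℚ 2 * Kf (Hᵏ k) (proj₁ (Ωᵏ k)) + KfAdd (Hᵏ k) (proj₁ (Ωᵏ k)) + KfMul (Hᵏ k) (proj₁ (Ωᵏ k)) * ½
      + (νᵏ k * (μᵏ k - νᵏ k + 1ℚ) + μᵏ k * (μᵏ k - νᵏ k)) * ½
      ≡⟨ cong₃ (λ x y z → ℕ→ℚ 2 * x + y + z * ½ + (νᵏ k * (μᵏ k - νᵏ k + 1ℚ) + μᵏ k * (μᵏ k - νᵏ k)) * ½)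
           (Kf-Sᵏ k) (KfAdd-Sᵏ k) (KfMul-Sᵏ k) ⟩
    ℕ→ℚ 2 * Kfᶜ′ (α k) + KfAddᶜ (α k) + KfMulᶜ (α k) * ½ + (νᵏ k * (μᵏ k - νᵏ k + 1ℚ) + μᵏ k * (μᵏ k - νᵏ k)) * ½
      ≡⟨ cong₂ (λ y z → ℕ→ℚ 2 * Kfᶜ′ (α k) + KfAddᶜ (α k) + KfMulᶜ (α k) * ½ + (z * (y - z + 1ℚ) + y * (y - z)) * ½)
           (edges-Sᵏ k) (vertices-Sᵏ k) ⟩
    ℕ→ℚ 2 * Kfᶜ′ (α k) + KfAddᶜ (α k) + KfMulᶜ (α k) * ½
      + ((α k * μ - d) * (α k * μ - (α k * μ - d) + 1ℚ) + α k * μ * (α k * μ - (α k * μ - d))) * ½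
      ≡⟨ Kfᶜ-step (α k) ⟩
    Kfᶜ′ (ℕ→ℚ 2 * α k)
      ≡⟨ cong Kfᶜ′ (α-suc k) ⟨
    Kfᶜ′ (α (suc k))  ∎
    where open ≡-Reasoning

theorem3p4 : (G : Graph) → Simple G → Connected G → 2 ≤ n G → (k : ℕ)
    → (Ω : PairFn G) → IsResistanceDistance G Ω
    → (Ωₖ : PairFn (Sᵏ k G)) → IsResistanceDistance (Sᵏ k G) Ωₖ
    → Kf (Sᵏ k G) Ωₖ
      ≡ ℕ→ℚ (2 ^ k) * Kf G Ω
        + (ℕ→ℚ (4 ^ k) - ℕ→ℚ (2 ^ k)) * (+ 1 / 2) * KfAdd G Ω
        + (ℕ→ℚ (8 ^ k) - ℕ→ℚ 2 * ℕ→ℚ (4 ^ k) + ℕ→ℚ (2 ^ k)) * (+ 1 / 4) * KfMul G Ω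
        + (ℕ→ℚ (8 ^ k) - ℕ→ℚ (2 ^ k)) * (+ 1 / 12)
            * (ℕ→ℚ (m G) * (ℕ→ℚ 2 * ℕ→ℚ (m G) - ℕ→ℚ 2 * ℕ→ℚ (n G) + ℕ→ℚ 1))
        - (ℕ→ℚ (4 ^ k) - ℕ→ℚ 1) * (+ 1 / 6)
            * ((ℕ→ℚ (m G) - ℕ→ℚ (n G)) * (ℕ→ℚ (m G) - ℕ→ℚ (n G) + ℕ→ℚ 1))
theorem3p4 G _ _ 2≤n k Ω isRD Ωₖ isRDₖ = begin
  Kf (Sᵏ k G) Ωₖ                              ≡⟨ Kf-unique (Sᵏ k G) isRDₖ (proj₂ (Ωᵏ G isRD r k)) ⟩
  Kf (Sᵏ k G) (proj₁ (Ωᵏ G isRD r k))         ≡⟨ Kf-Sᵏ G isRD r k ⟩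
  Kfᶜ G isRD r α (α * α) (α * α * α)          ≡⟨ cong₂ (Kfᶜ G isRD r α) (sym 4^k≡α²) (sym 8^k≡α³) ⟩
  Kfᶜ G isRD r α (ℕ→ℚ (4 ^ k)) (ℕ→ℚ (8 ^ k))  ∎
  where
  open ≡-Reasoning
  r : Fin (n G)
  r = Fin.fromℕ< 2≤n
  α : ℚ
  α = ℕ→ℚ (2 ^ k)
  4^k≡α² : ℕ→ℚ (4 ^ k) ≡ α * α
  4^k≡α² = trans (cong ℕ→ℚ (^-distribʳ-* 2 2 k)) (ℕ→ℚ-* (2 ^ k) (2 ^ k))
  8^k≡α³ : ℕ→ℚ (8 ^ k) ≡ α * α * α
  8^k≡α³ = trans (cong ℕ→ℚ (^-distribʳ-* 4 2 k)) (trans (ℕ→ℚ-* (4 ^ k) (2 ^ k)) (cong (_* α) 4^k≡α²))
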